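{- For any integers $n\ge2$ and $m\ge1$, the number of admissible pinnacle sets of $\mathbb{Z}_m\wr S_n$ is \[ \#\mathrm{APS}(m,n)=(-1)^{\lfloor\frac{n-1}{2}\rfloor}\sum_{i=0}^{\lfloor\frac{n-1}{2}\rfloor}\binom{n}{i}m^i(-1)^i=\sum_{k=0}^{\lfloor\frac{n-1}{2}\rfloor}(m-1)^k\binom{n}{k}\binom{n-k-1}{\lfloor\frac{n-1}{2}\rfloor-k}. \] In particular, $\#\mathrm{APS}(m,n)$ grows exponentially with $n$ but polynomially with $m$.
   Context: Let $m,n$ be positive integers, $[n]=\{1,\dots,n\}$, $\xi=e^{2\pi i/m}$. For $0\le a\le m-1$, $x\in[n]$, $\xi^a(x)$ denotes $\xi^a\cdot x$; $\mathbb{I}_n^m=\bigcup_{a=0}^{m-1}\{\xi^a(1),\dots,\xi^a(n)\}$, totally ordered by $\xi^a(x)\prec\xi^b(y)$ iff $a>b$, or $a=b$ and $x>y$. $\mathbb{Z}_m\wr S_n$ is the group of bijections $w$ of $\mathbb{I}_n^m$ with $w(\xi^i x)=\xi^i w(x)$ for $x\in[n]$ and all $i$, written $w(n)\cdots w(1)$. $\operatorname{Pin}(w)=\{w(i):2\le i\le n-1,\ w(i+1)\prec w(i)\succ w(i-1)\}$. $P\subseteq\mathbb{I}_n^m$ is an admissible pinnacle set if $P=\operatorname{Pin}(w)$ for some $w\in\mathbb{Z}_m\wr S_n$; $\mathrm{APS}(m,n)$ is the set of all admissible pinnacle sets. Convention $0^0=1$. -}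

module Defs where

open import Data.Nat using (ℕ; zero; suc; _+_; _*_; _∸_; _^_; _≤_; _<_)
open import Data.Nat.DivMod using (_/_)
open import Data.Nat.Combinatorics using (_C_)
open import Data.Fin as F using (Fin; toℕ)
open import Data.Fin.Subset using (Subset; inside)
open import Data.Vec using (Vec; lookup)
open import Data.List using (List; map; upTo; length)
open import Data.Nat.ListAction using (sum)
open import Data.List.Membership.Propositional using (_∈_)
open import Data.List.Relation.Unary.Unique.Propositional using (Unique)
open import Data.Product using (Σ; _×_; _,_; ∃; proj₁)
open import Data.Sum using (_⊎_)
open import Function.Definitions using (Injective)
open import Function.Bundles using (_⇔_)
open import Relation.Binary.PropositionalEquality using (_≡_)
import Data.Integer as ℤ

-- An element ξ^a(x) of 𝕀_n^m, encoded as (a , x) with a : Fin m and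
-- x : Fin n standing for the integer (toℕ x + 1) ∈ [n].
El : ℕ → ℕ → Set
El m n = Fin m × Fin n

_≺_ : ∀ {m n} → El m n → El m n → Set
(a , x) ≺ (b , y) = (b F.< a) ⊎ ((a ≡ b) × (y F.< x))

-- An element of ℤ_m ≀ S_n is determined by its values w(1),…,w(n):
-- w(i) = ξ^{colour i}(σ i) with σ a permutation of [n] (injective on Fin n).
-- Positions are 0-based: position p : Fin n stands for i = toℕ p + 1.
record ColPerm (m n : ℕ) : Set where
  field
    colour : Fin n → Fin m
    σ      : Fin n → Fin n
    σ-inj  : Injective _≡_ _≡_ σ

  w : Fin n → El m n
  w p = (colour p , σ p)

open ColPerm public

IsPinnacle : ∀ {m n} → ColPerm m n → El m n → Set
IsPinnacle {m} {n} π e =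
  Σ (Fin n) λ h → Σ (Fin n) λ i → Σ (Fin n) λ j →
    (toℕ i ≡ suc (toℕ h)) × (toℕ j ≡ suc (toℕ i)) ×
    (w π i ≡ e) × (w π j ≺ w π i) × (w π h ≺ w π i)

SubsetI : ℕ → ℕ → Set
SubsetI m n = Vec (Subset n) m

_∈I_ : ∀ {m n} → El m n → SubsetI m n → Set
(a , x) ∈I P = lookup (lookup P a) x ≡ inside

IsPinSet : ∀ {m n} → ColPerm m n → SubsetI m n → Set
IsPinSet π P = ∀ e → (e ∈I P) ⇔ IsPinnacle π e

Admissible : (m n : ℕ) → SubsetI m n → Set
Admissible m n P = ∃ λ (π : ColPerm m n) → IsPinSet π P

NumAPS : ℕ → ℕ → ℕ → Set
NumAPS m n N = Σ (List (SubsetI m n)) λ L →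
  Unique L × (∀ P → (P ∈ L) ⇔ Admissible m n P) × (length L ≡ N)

sumTo : ℕ → (ℕ → ℕ) → ℕ
sumTo d f = sum (map f (upTo (suc d)))

sumToℤ : ℕ → (ℕ → ℤ.ℤ) → ℤ.ℤ
sumToℤ zero    f = f 0
sumToℤ (suc d) f = sumToℤ d f ℤ.+ f (suc d)

halfFloor : ℕ → ℕ
halfFloor n = (n ∸ 1) / 2

formulaℕ : ℕ → ℕ → ℕ
formulaℕ m n = sumTo d λ k → ((m ∸ 1) ^ k) * (n C k) * ((n ∸ k ∸ 1) C (d ∸ k))
  where d = halfFloor n

formulaℤ : ℕ → ℕ → ℤ.ℤ
formulaℤ m n = ((ℤ.- ℤ.+ 1) ℤ.^ d) ℤ.*
  sumToℤ d (λ i → ℤ.+ ((n C i) * (m ^ i)) ℤ.* ((ℤ.- ℤ.+ 1) ℤ.^ i))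
  where d = halfFloor n

{-# OPTIONS --safe #-}

-- Write m = t + 1, so that ξ^t is the lowest colour.  In a pinnacle set every value x occurs
-- with at most one colour, so the set is described by a status vector: x is plain (absent), low
-- (ξ^t(x) is a pinnacle) or high (ξ^c(x) is a pinnacle for some c < t).  A status vector comes
-- from a pinnacle set exactly when at most d = ⌊(n-1)/2⌋ values are not plain and every low
-- value has two more plain than low values below it.  Necessity: in any down-closed set of
-- elements, reading the arrangement from left to right, each pinnacle uses up the non-pinnacle
-- to its right and the first pinnacle also the one to its left.  Sufficiency: interleave the
-- plain values, in increasing order, with the low values in increasing order followed by the
-- high ones.  Counting status vectors with k high and l low values gives t^k (n C k) times a
-- ballot number, and the ballot numbers for l ≤ d - k add up to (n-k-1) C (d-k).  The
-- alternating sum satisfies the same Pascal recurrence in n and d, with the same boundary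
-- values.

module Submission where

open import Defs
open import Data.Nat using (ℕ; _≤_)
open import Data.Product using (Σ; _×_)
open import Relation.Binary.PropositionalEquality using (_≡_)
import Data.Integer as ℤ

open import Algebra.Properties.CommutativeSemigroup using (interchange)
open import Data.Bool using (Bool; true; false; if_then_else_; _∧_; not)
open import Data.Bool.ListAction using (any)
import Data.Bool.Properties as Bₚ
open import Data.Bool.Properties using (T?; T-≡; ∧-zeroʳ; ∧-identityʳ; ¬-not)
open import Data.Empty using (⊥; ⊥-elim)
open import Data.Fin as F using (Fin; toℕ; fromℕ; inject₁)
import Data.Fin.Properties as Fₚ
open import Data.Fin.Properties using (_≟_; toℕ<n; toℕ-fromℕ; toℕ-inject₁; fromℕ≢inject₁; inject₁-injective)
import Data.Integer.Properties as ℤₚ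
import Data.Integer.Solver as ℤ-Solver
open import Data.List as L
  using (List; []; _∷_; _++_; map; applyUpTo; length; filterᵇ; allFin; cartesianProductWith)
import Data.List.Properties as Lₚ
open import Data.List.Membership.Propositional using (_∈_)
open import Data.List.Membership.Propositional.Properties
  using (∈-++⁻; ∈-tabulate⁺; ∈-map⁺; ∈-map⁻; ∈-filter⁺; ∈-filter⁻; ∈-cartesianProductWith⁺)
open import Data.List.Relation.Binary.Permutation.Propositional
  using (_↭_; ↭-refl; ↭-reflexive; ↭-prep; ↭-trans; ↭-sym; ↭⇒↭ₛ)
import Data.List.Relation.Binary.Permutation.Propositional.Properties as ↭ₚ
import Data.List.Relation.Binary.Permutation.Setoid.Properties as ↭ₛₚ
open import Data.List.Relation.Unary.All as All using (All; []; _∷_)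
import Data.List.Relation.Unary.All.Properties as Allₚ
open import Data.List.Relation.Unary.AllPairs using ([]; _∷_)
open import Data.List.Relation.Unary.Any using (here; there)
open import Data.List.Relation.Unary.Linked as Linked using (Linked; []; [-]; _∷_)
import Data.List.Relation.Unary.Linked.Properties as Linkedₚ
open import Data.List.Relation.Unary.Unique.Propositional using (Unique)
import Data.List.Relation.Unary.Unique.Propositional.Properties as Uniqueₚ
open import Data.Maybe as M using (Maybe; just; nothing)
open import Data.Maybe.Properties using (just-injective)
open import Data.Nat using (zero; suc; _+_; _*_; _∸_; _^_; _<_; _≤ᵇ_; _≡ᵇ_; _≤?_; z≤n; s≤s; z<s)
open import Data.Nat.Combinatorics using (_C_; nCk+nC[k+1]≡[n+1]C[k+1]; k>n⇒nCk≡0; nCn≡1; nCk≡nC[n∸k])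
open import Data.Nat.DivMod using (_/_; m/n*n≤m; m*n/n≡m; /-monoˡ-≤)
open import Data.Nat.ListAction using (sum)
open import Data.Nat.Properties hiding (_≟_)
import Data.Nat.Solver as ℕ-Solver
open import Data.Product using (_,_; proj₁; proj₂)
open import Data.Sum using (_⊎_; inj₁; inj₂; [_,_]′)
open import Data.Unit using (⊤; tt)
open import Data.Vec as V using (Vec; []; _∷_)
import Data.Vec.Properties as Vₚ
open import Data.Vec.Properties using (lookup∘tabulate; lookup-map; tabulate∘lookup; tabulate-cong)
open import Function using (_∘_; id; _⟨_⟩_; case_of_)
open import Function.Bundles using (Equivalence; mk⇔; _⇔_)
open import Relation.Binary.PropositionalEquality
  using (_≢_; refl; sym; trans; cong; cong₂; subst; subst₂; module ≡-Reasoning)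
  renaming (setoid to ≡-setoid)
open import Relation.Nullary using (¬_; Dec; contradiction; yes; no; does)
open import Relation.Nullary.Decidable using (dec-true; dec-false)
open import Relation.Nullary.Reflects using (det; fromEquivalence)

∑≤ : ℕ → (ℕ → ℕ) → ℕ
∑≤ zero    f = f 0
∑≤ (suc e) f = f 0 + ∑≤ e (f ∘ suc)

syntax ∑≤ e (λ k → x) = ∑[ k ≤ e ] x

∑≤-cong : ∀ e {f g : ℕ → ℕ} → (∀ {k} → k ≤ e → f k ≡ g k) → ∑≤ e f ≡ ∑≤ e g
∑≤-cong zero    f≗g = f≗g z≤n
∑≤-cong (suc e) f≗g = cong₂ _+_ (f≗g z≤n) (∑≤-cong e (f≗g ∘ s≤s))

∑≤-zero : ∀ e {f : ℕ → ℕ} → (∀ {k} → k ≤ e → f k ≡ 0) → ∑≤ e f ≡ 0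
∑≤-zero zero    f≗0 = f≗0 z≤n
∑≤-zero (suc e) f≗0 = cong₂ _+_ (f≗0 z≤n) (∑≤-zero e (f≗0 ∘ s≤s))

∑≤-distrib-+ : ∀ e (f g : ℕ → ℕ) → ∑[ k ≤ e ] (f k + g k) ≡ ∑≤ e f + ∑≤ e g
∑≤-distrib-+ zero    f g = refl
∑≤-distrib-+ (suc e) f g =
  cong (f 0 + g 0 +_) (∑≤-distrib-+ e (f ∘ suc) (g ∘ suc)) ⟨ trans ⟩ interchange +-commutativeSemigroup (f 0) (g 0) _ _

*-distribˡ-∑≤ : ∀ e a (f : ℕ → ℕ) → a * ∑≤ e f ≡ ∑[ k ≤ e ] (a * f k)
*-distribˡ-∑≤ zero    a f = refl
*-distribˡ-∑≤ (suc e) a f = *-distribˡ-+ a (f 0) _ ⟨ trans ⟩ cong (a * f 0 +_) (*-distribˡ-∑≤ e a (f ∘ suc))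

∑≤-last : ∀ e (f : ℕ → ℕ) → ∑≤ (suc e) f ≡ ∑≤ e f + f (suc e)
∑≤-last zero    f = refl
∑≤-last (suc e) f = cong (f 0 +_) (∑≤-last e (f ∘ suc)) ⟨ trans ⟩ sym (+-assoc (f 0) _ _)

sumTo≡∑≤ : ∀ d f → sumTo d f ≡ ∑≤ d f
sumTo≡∑≤ d f = go d f id
  where
  go : ∀ e (f g : ℕ → ℕ) → sum (map f (applyUpTo g (suc e))) ≡ ∑≤ e (f ∘ g)
  go zero    f g = +-identityʳ (f (g 0))
  go (suc e) f g = cong (f (g 0) +_) (go e f (g ∘ suc))

-- The closed form and its Pascal recurrence

binomialTerm : ℕ → ℕ → ℕ → ℕ → ℕ
binomialTerm t n e k = t ^ k * (n C k) * ((n ∸ k ∸ 1) C (e ∸ k))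

closedForm : ℕ → ℕ → ℕ → ℕ
closedForm t n e = ∑[ k ≤ e ] binomialTerm t n e k

formulaℕ≡closedForm : ∀ t n → formulaℕ (suc t) n ≡ closedForm t n (halfFloor n)
formulaℕ≡closedForm t n = sumTo≡∑≤ (halfFloor n) _

if-≤ᵇ-true : ∀ {k e} → k ≤ e → {A : Set} (x y : A) → (if k ≤ᵇ e then x else y) ≡ x
if-≤ᵇ-true {k} {e} k≤e x y with k ≤ᵇ e | ≤⇒≤ᵇ k≤e
... | true | _ = refl

if-≤ᵇ-false : ∀ {k e} → e < k → {A : Set} (x y : A) → (if k ≤ᵇ e then x else y) ≡ y
if-≤ᵇ-false {k} {e} e<k x y with k ≤ᵇ e | ≤ᵇ⇒≤ k e
... | false | _   = refl
... | true  | k≤e = contradiction (k≤e _) (<⇒≱ e<k)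

≤⇒≤ᵇ≡true : ∀ {k e} → k ≤ e → (k ≤ᵇ e) ≡ true
≤⇒≤ᵇ≡true = Equivalence.to T-≡ ∘ ≤⇒≤ᵇ

≤ᵇ≡true⇒≤ : ∀ {k e} → (k ≤ᵇ e) ≡ true → k ≤ e
≤ᵇ≡true⇒≤ {k} {e} = ≤ᵇ⇒≤ k e ∘ Equivalence.from T-≡

if-*ʳ : ∀ (b : Bool) x y → (if b then x * y else 0) ≡ x * (if b then y else 0)
if-*ʳ true  x y = refl
if-*ʳ false x y = sym (*-zeroʳ x)

closedForm-diagonal : ∀ t n → closedForm t n n ≡ t ^ n
closedForm-diagonal t zero    = refl
closedForm-diagonal t (suc n) = begin
  closedForm t (suc n) (suc n)
    ≡⟨ ∑≤-last n _ ⟩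
  ∑[ k ≤ n ] binomialTerm t (suc n) (suc n) k + binomialTerm t (suc n) (suc n) (suc n)
    ≡⟨ cong₂ _+_ (∑≤-zero n vanish) last ⟩
  t ^ suc n ∎
  where
  open ≡-Reasoning
  vanish : ∀ {k} → k ≤ n → binomialTerm t (suc n) (suc n) k ≡ 0
  vanish {k} k≤n = begin
    t ^ k * (suc n C k) * ((suc n ∸ k ∸ 1) C (suc n ∸ k))
      ≡⟨ cong (λ j → t ^ k * (suc n C k) * ((j ∸ 1) C j)) (+-∸-assoc 1 k≤n) ⟩
    t ^ k * (suc n C k) * ((n ∸ k) C suc (n ∸ k))
      ≡⟨ cong (t ^ k * (suc n C k) *_) (k>n⇒nCk≡0 (n<1+n (n ∸ k))) ⟩
    t ^ k * (suc n C k) * 0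
      ≡⟨ *-zeroʳ (t ^ k * (suc n C k)) ⟩
    0 ∎
  last : binomialTerm t (suc n) (suc n) (suc n) ≡ t ^ suc n
  last = begin
    t ^ suc n * (suc n C suc n) * ((n ∸ n ∸ 1) C (n ∸ n))
      ≡⟨ cong₂ (λ a j → t ^ suc n * a * ((j ∸ 1) C j)) (nCn≡1 (suc n)) (n∸n≡0 n) ⟩
    t ^ suc n * 1 * 1
      ≡⟨ *-identityʳ _ ⟨ trans ⟩ *-identityʳ _ ⟩
    t ^ suc n ∎

pascal-shifted : ∀ j e N → e ∸ j ≤ N →
  N C (e ∸ j) ≡ (N ∸ 1) C (e ∸ j) + (if suc j ≤ᵇ e then (N ∸ 1) C (e ∸ suc j) else 0)
pascal-shifted zero    zero     N       _ = refl
pascal-shifted zero    (suc e)  (suc N) _ =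
  sym (+-comm (N C suc e) (N C e) ⟨ trans ⟩ nCk+nC[k+1]≡[n+1]C[k+1] N e)
pascal-shifted (suc j) zero     N       _ = refl
pascal-shifted (suc j) (suc e)  N       h = pascal-shifted j e N h

-- The k-th summand of closedForm t n e, cut off to 0 beyond k = e, so that closed forms with
-- different upper limits can be compared summand by summand.
guardedTerm : ℕ → ℕ → ℕ → ℕ → ℕ
guardedTerm t n e k = if k ≤ᵇ e then binomialTerm t n e k else 0

shiftedTerm : ℕ → ℕ → ℕ → ℕ → ℕ
shiftedTerm t n e zero    = 0
shiftedTerm t n e (suc k) = t * guardedTerm t n e k

∑-guardedTerm : ∀ t n e → ∑≤ e (guardedTerm t n e) ≡ closedForm t n e
∑-guardedTerm t n e = ∑≤-cong e (λ k≤e → if-≤ᵇ-true k≤e _ 0)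

∑-guardedTerm-beyond : ∀ t n e → ∑≤ (suc e) (guardedTerm t n e) ≡ closedForm t n e
∑-guardedTerm-beyond t n e = begin
  ∑≤ (suc e) (guardedTerm t n e)                 ≡⟨ ∑≤-last e _ ⟩
  ∑≤ e (guardedTerm t n e) + guardedTerm t n e (suc e)
    ≡⟨ cong₂ _+_ (∑-guardedTerm t n e) (if-≤ᵇ-false (n<1+n e) _ 0) ⟩
  closedForm t n e + 0                           ≡⟨ +-identityʳ _ ⟩
  closedForm t n e ∎
  where open ≡-Reasoning

∑-shiftedTerm : ∀ t n e → ∑≤ (suc e) (shiftedTerm t n e) ≡ t * closedForm t n e
∑-shiftedTerm t n e = sym (*-distribˡ-∑≤ e t _) ⟨ trans ⟩ cong (t *_) (∑-guardedTerm t n e)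

guardedTerm-pascal : ∀ t n e {k} → suc e ≤ n → k ≤ suc e →
  guardedTerm t (suc n) (suc e) k ≡ guardedTerm t n (suc e) k + guardedTerm t n e k + shiftedTerm t n e k
guardedTerm-pascal t (suc n) e {zero} _ _ = begin
  1 * 1 * (suc n C suc e)        ≡⟨ *-identityˡ _ ⟩
  suc n C suc e                  ≡⟨ sym (nCk+nC[k+1]≡[n+1]C[k+1] n e) ⟩
  n C e + n C suc e              ≡⟨ +-comm (n C e) (n C suc e) ⟩
  n C suc e + n C e              ≡⟨ cong₂ _+_ (sym (*-identityˡ (n C suc e))) (sym (*-identityˡ (n C e))) ⟩
  1 * 1 * (n C suc e) + 1 * 1 * (n C e)   ≡⟨ sym (+-identityʳ _) ⟩
  1 * 1 * (n C suc e) + 1 * 1 * (n C e) + 0 ∎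
  where open ≡-Reasoning
guardedTerm-pascal t n e {suc j} se≤n (s≤s j≤e) = begin
  guardedTerm t (suc n) (suc e) (suc j)
    ≡⟨ if-≤ᵇ-true (s≤s j≤e) _ 0 ⟩
  t * p * (suc n C suc j) * ((n ∸ j ∸ 1) C E)
    ≡⟨ cong₂ (λ c x → t * p * c * x) (sym (nCk+nC[k+1]≡[n+1]C[k+1] n j)) pascal ⟩
  t * p * (cA + cB) * (Y + G)
    ≡⟨ solve 6 (λ t p cA cB Y G → t :* p :* (cA :+ cB) :* (Y :+ G) :=
         t :* p :* cB :* Y :+ t :* p :* cB :* G :+ t :* (p :* cA :* (Y :+ G))) refl t p cA cB Y G ⟩
  t * p * cB * Y + t * p * cB * G + t * (p * cA * (Y + G))
    ≡⟨ cong₂ _+_ (cong₂ _+_ (sym (if-≤ᵇ-true (s≤s j≤e) _ 0)) (sym (if-*ʳ (suc j ≤ᵇ e) (t * p * cB) _)))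
                 (cong (t *_) (sym (if-≤ᵇ-true j≤e _ 0 ⟨ trans ⟩ cong (p * cA *_) pascal))) ⟩
  guardedTerm t n (suc e) (suc j) + guardedTerm t n e (suc j) + t * guardedTerm t n e j ∎
  where
  open ≡-Reasoning
  open ℕ-Solver.+-*-Solver
  p = t ^ j
  cA = n C j
  cB = n C suc j
  N = n ∸ suc j
  E = e ∸ j
  Y = (N ∸ 1) C E
  G = if suc j ≤ᵇ e then (N ∸ 1) C (e ∸ suc j) else 0
  pascal : (n ∸ j ∸ 1) C E ≡ Y + G
  pascal = cong (_C E) (∸-+-assoc n j 1 ⟨ trans ⟩ cong (n ∸_) (+-comm j 1)) ⟨ trans ⟩
           (pascal-shifted j e N (∸-monoˡ-≤ j (∸-monoˡ-≤ 1 se≤n) ⟨ ≤-trans ⟩ ≤-reflexive (∸-+-assoc n 1 j)))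

closedForm-pascal : ∀ t n e → suc e ≤ n →
  closedForm t (suc n) (suc e) ≡ closedForm t n (suc e) + suc t * closedForm t n e
closedForm-pascal t n e se≤n = begin
  closedForm t (suc n) (suc e)
    ≡⟨ sym (∑-guardedTerm t (suc n) (suc e)) ⟩
  ∑≤ (suc e) (guardedTerm t (suc n) (suc e))
    ≡⟨ ∑≤-cong (suc e) (guardedTerm-pascal t n e se≤n) ⟩
  ∑[ k ≤ suc e ] (A k + B k + C k)
    ≡⟨ ∑≤-distrib-+ (suc e) (λ k → A k + B k) C ⟨ trans ⟩ cong (_+ ∑≤ (suc e) C) (∑≤-distrib-+ (suc e) A B) ⟩
  ∑≤ (suc e) A + ∑≤ (suc e) B + ∑≤ (suc e) C
    ≡⟨ cong₂ _+_ (cong₂ _+_ (∑-guardedTerm t n (suc e)) (∑-guardedTerm-beyond t n e)) (∑-shiftedTerm t n e) ⟩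
  closedForm t n (suc e) + closedForm t n e + t * closedForm t n e
    ≡⟨ +-assoc (closedForm t n (suc e)) _ _ ⟩
  closedForm t n (suc e) + suc t * closedForm t n e ∎
  where
  open ≡-Reasoning
  A = guardedTerm t n (suc e)
  B = guardedTerm t n e
  C = shiftedTerm t n e

-- The alternating form

alternatingTerm : ℕ → ℕ → ℕ → ℤ.ℤ
alternatingTerm m n i = ℤ.+ ((n C i) * (m ^ i)) ℤ.* (ℤ.-1ℤ ℤ.^ i)

alternatingSum : ℕ → ℕ → ℕ → ℤ.ℤ
alternatingSum m n e = sumToℤ e (alternatingTerm m n)

signedForm : ℕ → ℕ → ℕ → ℤ.ℤ
signedForm m n e = (ℤ.-1ℤ ℤ.^ e) ℤ.* alternatingSum m n e

alternatingTerm-pascal : ∀ m n i →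
  alternatingTerm m (suc n) (suc i) ≡ alternatingTerm m n (suc i) ℤ.- ℤ.+ m ℤ.* alternatingTerm m n i
alternatingTerm-pascal m n i = begin
  ℤ.+ ((suc n C suc i) * (m * q)) ℤ.* s′
    ≡⟨ cong (λ c → ℤ.+ (c * (m * q)) ℤ.* s′) (sym (nCk+nC[k+1]≡[n+1]C[k+1] n i)) ⟩
  ℤ.+ ((a + b) * (m * q)) ℤ.* s′
    ≡⟨ cong (ℤ._* s′) (ℤₚ.pos-* (a + b) _ ⟨ trans ⟩ cong₂ ℤ._*_ (ℤₚ.pos-+ a b) (ℤₚ.pos-* m q)) ⟩
  (ℤ.+ a ℤ.+ ℤ.+ b) ℤ.* (ℤ.+ m ℤ.* ℤ.+ q) ℤ.* s′
    ≡⟨ solve 5 (λ a b m q s → (a :+ b) :* (m :* q) :* (:- con (ℤ.+ 1) :* s) :=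
                 b :* (m :* q) :* (:- con (ℤ.+ 1) :* s) :- m :* (a :* q :* s))
               refl (ℤ.+ a) (ℤ.+ b) (ℤ.+ m) (ℤ.+ q) s ⟩
  ℤ.+ b ℤ.* (ℤ.+ m ℤ.* ℤ.+ q) ℤ.* s′ ℤ.- ℤ.+ m ℤ.* (ℤ.+ a ℤ.* ℤ.+ q ℤ.* s)
    ≡⟨ cong₂ (λ x y → x ℤ.* s′ ℤ.- ℤ.+ m ℤ.* (y ℤ.* s))
             (cong (ℤ.+ b ℤ.*_) (sym (ℤₚ.pos-* m q)) ⟨ trans ⟩ sym (ℤₚ.pos-* b (m * q))) (sym (ℤₚ.pos-* a q)) ⟩
  ℤ.+ (b * (m * q)) ℤ.* s′ ℤ.- ℤ.+ m ℤ.* alternatingTerm m n i ∎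
  where
  open ≡-Reasoning
  open ℤ-Solver.+-*-Solver
  a = n C i
  b = n C suc i
  q = m ^ i
  s = ℤ.-1ℤ ℤ.^ i
  s′ = ℤ.-1ℤ ℤ.* s

alternatingSum-pascal : ∀ m n e →
  alternatingSum m (suc n) (suc e) ≡ alternatingSum m n (suc e) ℤ.- ℤ.+ m ℤ.* alternatingSum m n e
alternatingSum-pascal m n zero = begin
  ℤ.1ℤ ℤ.+ alternatingTerm m (suc n) 1
    ≡⟨ cong (λ x → ℤ.1ℤ ℤ.+ x) (alternatingTerm-pascal m n 0) ⟩
  ℤ.1ℤ ℤ.+ (alternatingTerm m n 1 ℤ.- ℤ.+ m ℤ.* ℤ.1ℤ)
    ≡⟨ sym (ℤₚ.+-assoc ℤ.1ℤ (alternatingTerm m n 1) (ℤ.- (ℤ.+ m ℤ.* ℤ.1ℤ))) ⟩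
  ℤ.1ℤ ℤ.+ alternatingTerm m n 1 ℤ.- ℤ.+ m ℤ.* ℤ.1ℤ ∎
  where open ≡-Reasoning
alternatingSum-pascal m n (suc e) = begin
  alternatingSum m (suc n) (suc e) ℤ.+ alternatingTerm m (suc n) (suc (suc e))
    ≡⟨ cong₂ ℤ._+_ (alternatingSum-pascal m n e) (alternatingTerm-pascal m n (suc e)) ⟩
  (S₁ ℤ.- ℤ.+ m ℤ.* S₀) ℤ.+ (T₂ ℤ.- ℤ.+ m ℤ.* T₁)
    ≡⟨ solve 5 (λ S₁ S₀ T₂ T₁ m → (S₁ :- m :* S₀) :+ (T₂ :- m :* T₁) := (S₁ :+ T₂) :- m :* (S₀ :+ T₁))
               refl S₁ S₀ T₂ T₁ (ℤ.+ m) ⟩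
  (S₁ ℤ.+ T₂) ℤ.- ℤ.+ m ℤ.* (S₀ ℤ.+ T₁) ∎
  where
  open ≡-Reasoning
  open ℤ-Solver.+-*-Solver
  S₁ = alternatingSum m n (suc e)
  S₀ = alternatingSum m n e
  T₂ = alternatingTerm m n (suc (suc e))
  T₁ = alternatingTerm m n (suc e)

signedForm-pascal : ∀ m n e →
  signedForm m (suc n) (suc e) ≡ signedForm m n (suc e) ℤ.+ ℤ.+ m ℤ.* signedForm m n e
signedForm-pascal m n e = begin
  (ℤ.-1ℤ ℤ.* s) ℤ.* alternatingSum m (suc n) (suc e)
    ≡⟨ cong ((ℤ.-1ℤ ℤ.* s) ℤ.*_) (alternatingSum-pascal m n e) ⟩
  (ℤ.-1ℤ ℤ.* s) ℤ.* (S₁ ℤ.- ℤ.+ m ℤ.* S₀)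
    ≡⟨ solve 4 (λ s S₁ S₀ m → (:- con (ℤ.+ 1) :* s) :* (S₁ :- m :* S₀) :=
                 (:- con (ℤ.+ 1) :* s) :* S₁ :+ m :* (s :* S₀))
               refl s S₁ S₀ (ℤ.+ m) ⟩
  (ℤ.-1ℤ ℤ.* s) ℤ.* S₁ ℤ.+ ℤ.+ m ℤ.* signedForm m n e ∎
  where
  open ≡-Reasoning
  open ℤ-Solver.+-*-Solver
  s = ℤ.-1ℤ ℤ.^ e
  S₁ = alternatingSum m n (suc e)
  S₀ = alternatingSum m n e

alternatingSum-beyond : ∀ m n → alternatingSum m n (suc n) ≡ alternatingSum m n n
alternatingSum-beyond m n =
  cong (λ c → alternatingSum m n n ℤ.+ ℤ.+ (c * m ^ suc n) ℤ.* (ℤ.-1ℤ ℤ.^ suc n)) (k>n⇒nCk≡0 (n<1+n n))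
  ⟨ trans ⟩ ℤₚ.+-identityʳ _

signedForm-diagonal : ∀ t n → signedForm (suc t) n n ≡ ℤ.+ (t ^ n)
signedForm-diagonal t zero    = refl
signedForm-diagonal t (suc n) = begin
  (ℤ.-1ℤ ℤ.* s) ℤ.* alternatingSum (suc t) (suc n) (suc n)
    ≡⟨ cong ((ℤ.-1ℤ ℤ.* s) ℤ.*_) (alternatingSum-pascal (suc t) n n ⟨ trans ⟩
         cong (ℤ._- ℤ.+ suc t ℤ.* S) (alternatingSum-beyond (suc t) n)) ⟩
  (ℤ.-1ℤ ℤ.* s) ℤ.* (S ℤ.- (ℤ.1ℤ ℤ.+ ℤ.+ t) ℤ.* S)
    ≡⟨ solve 3 (λ s S t → (:- con (ℤ.+ 1) :* s) :* (S :- (con (ℤ.+ 1) :+ t) :* S) := t :* (s :* S))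
               refl s S (ℤ.+ t) ⟩
  ℤ.+ t ℤ.* signedForm (suc t) n n
    ≡⟨ cong (ℤ.+ t ℤ.*_) (signedForm-diagonal t n) ⟩
  ℤ.+ t ℤ.* ℤ.+ (t ^ n)
    ≡⟨ sym (ℤₚ.pos-* t (t ^ n)) ⟩
  ℤ.+ (t ^ suc n) ∎
  where
  open ≡-Reasoning
  open ℤ-Solver.+-*-Solver
  s = ℤ.-1ℤ ℤ.^ n
  S = alternatingSum (suc t) n n

closedForm≡signedForm : ∀ t n e → e ≤ n → ℤ.+ closedForm t n e ≡ signedForm (suc t) n e
closedForm≡signedForm t n       zero    _ = refl
closedForm≡signedForm t (suc n) (suc e) se≤sn with m≤n⇒m<n∨m≡n se≤sn
... | inj₂ refl = cong (λ x → ℤ.+ x) (closedForm-diagonal t (suc n)) ⟨ trans ⟩ sym (signedForm-diagonal t (suc n))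
... | inj₁ (s≤s se≤n) = begin
  ℤ.+ closedForm t (suc n) (suc e)
    ≡⟨ cong (λ x → ℤ.+ x) (closedForm-pascal t n e se≤n) ⟩
  ℤ.+ (closedForm t n (suc e) + suc t * closedForm t n e)
    ≡⟨ ℤₚ.pos-+ (closedForm t n (suc e)) _ ⟨ trans ⟩
       cong (λ x → ℤ.+ closedForm t n (suc e) ℤ.+ x) (ℤₚ.pos-* (suc t) (closedForm t n e)) ⟩
  ℤ.+ closedForm t n (suc e) ℤ.+ ℤ.+ suc t ℤ.* ℤ.+ closedForm t n e
    ≡⟨ cong₂ (λ x y → x ℤ.+ ℤ.+ suc t ℤ.* y) (closedForm≡signedForm t n (suc e) se≤n)
                                              (closedForm≡signedForm t n e (<⇒≤ se≤n)) ⟩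
  signedForm (suc t) n (suc e) ℤ.+ ℤ.+ suc t ℤ.* signedForm (suc t) n e
    ≡⟨ sym (signedForm-pascal (suc t) n e) ⟩
  signedForm (suc t) (suc n) (suc e) ∎
  where open ≡-Reasoning

-- Ballot numbers

-- ballotNumber N l counts the status vectors of length N with l entries low, none high, that
-- satisfy the ballot condition; ballotNumberLowHead N l counts those of length suc N starting
-- with low.
ballotNumber        : ℕ → ℕ → ℕ
ballotNumberLowHead : ℕ → ℕ → ℕ

ballotNumber zero    zero    = 1
ballotNumber zero    (suc l) = 0
ballotNumber (suc N) l       = ballotNumber N l + ballotNumberLowHead N l

ballotNumberLowHead N zero    = 0
ballotNumberLowHead N (suc l) = if suc (suc (l + l)) ≤ᵇ N then ballotNumber N l else 0

ballotNumber-zero : ∀ N → ballotNumber N 0 ≡ 1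
ballotNumber-zero zero    = refl
ballotNumber-zero (suc N) = +-identityʳ _ ⟨ trans ⟩ ballotNumber-zero N

ballotNumber-vanish : ∀ N l → N ≤ suc (suc (l + l)) → ballotNumber N (suc l) ≡ 0
ballotNumber-vanish zero    l _         = refl
ballotNumber-vanish (suc N) l (s≤s N≤) =
  cong₂ _+_ (ballotNumber-vanish N l (m≤n⇒m≤1+n N≤)) (if-≤ᵇ-false (s≤s N≤) _ 0)

∑-ballotNumber-suc : ∀ N j → suc (suc (j + j)) ≤ N →
  ∑≤ (suc j) (ballotNumber (suc N)) ≡ ∑≤ (suc j) (ballotNumber N) + ∑≤ j (ballotNumber N)
∑-ballotNumber-suc N j 2j+2≤N =
  ∑≤-distrib-+ (suc j) (ballotNumber N) (ballotNumberLowHead N) ⟨ trans ⟩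
  cong (∑≤ (suc j) (ballotNumber N) +_)
       (∑≤-cong j λ l≤j → if-≤ᵇ-true (≤-trans (s≤s (s≤s (+-mono-≤ l≤j l≤j))) 2j+2≤N) _ 0)

central-symmetry : ∀ j → (j + suc j) C j ≡ (j + suc j) C suc j
central-symmetry j = nCk≡nC[n∸k] (m≤m+n j (suc j)) ⟨ trans ⟩ cong ((j + suc j) C_) (m+n∸m≡n j (suc j))

-- The two sums on the right of ∑-ballotNumber-suc satisfy the Pascal recurrence; when N = 2 j + 2
-- the last ballot number vanishes and the symmetry of the central binomial coefficient takes over.
∑-ballotNumber : ∀ N j → suc (j + j) ≤ N → ∑≤ j (ballotNumber N) ≡ (N ∸ 1) C j
∑-ballotNumber (suc N)       zero    _           = ballotNumber-zero (suc N)
∑-ballotNumber (suc zero)    (suc j) (s≤s ())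
∑-ballotNumber (suc (suc N)) (suc j) (s≤s 2j+1<N) = begin
  ∑≤ (suc j) (ballotNumber (suc (suc N)))
    ≡⟨ ∑-ballotNumber-suc (suc N) j (subst (_≤ suc N) (cong suc (+-suc j j)) 2j+1<N) ⟩
  ∑≤ (suc j) (ballotNumber (suc N)) + ∑≤ j (ballotNumber (suc N))
    ≡⟨ cong₂ _+_ ([ ∑-ballotNumber (suc N) (suc j) , boundary ]′ (m≤n⇒m<n∨m≡n 2j+1<N)) lower ⟩
  N C suc j + N C j
    ≡⟨ +-comm (N C suc j) (N C j) ⟨ trans ⟩ nCk+nC[k+1]≡[n+1]C[k+1] N j ⟩
  suc N C suc j ∎
  where
  open ≡-Reasoning
  lower : ∑≤ j (ballotNumber (suc N)) ≡ N C j
  lower = ∑-ballotNumber (suc N) j (≤-trans (s≤s (+-monoʳ-≤ j (n≤1+n j))) 2j+1<N)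
  boundary : suc (j + suc j) ≡ suc N → ∑≤ (suc j) (ballotNumber (suc N)) ≡ N C suc j
  boundary 2j+2≡N = begin
    ∑≤ (suc j) (ballotNumber (suc N))
      ≡⟨ ∑≤-last j (ballotNumber (suc N)) ⟩
    ∑≤ j (ballotNumber (suc N)) + ballotNumber (suc N) (suc j)
      ≡⟨ cong₂ _+_ lower (ballotNumber-vanish (suc N) j (≤-reflexive (sym 2j+2≡N ⟨ trans ⟩ cong suc (+-suc j j)))) ⟩
    N C j + 0
      ≡⟨ +-identityʳ (N C j) ⟩
    N C j
      ≡⟨ subst (λ n → n C j ≡ n C suc j) (suc-injective 2j+2≡N) (central-symmetry j) ⟩
    N C suc j ∎

-- Counting status vectors

indicator : Bool → ℕ
indicator true  = 1
indicator false = 0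

count : {A : Set} → (A → Bool) → List A → ℕ
count p []       = 0
count p (x ∷ xs) = indicator (p x) + count p xs

module _ {A : Set} where

  count-++ : ∀ (p : A → Bool) xs ys → count p (xs ++ ys) ≡ count p xs + count p ys
  count-++ p []       ys = refl
  count-++ p (x ∷ xs) ys = cong (indicator (p x) +_) (count-++ p xs ys) ⟨ trans ⟩ sym (+-assoc (indicator (p x)) _ _)

  count-map : ∀ {B : Set} (p : B → Bool) (f : A → B) xs → count p (map f xs) ≡ count (p ∘ f) xs
  count-map p f []       = refl
  count-map p f (x ∷ xs) = cong (indicator (p (f x)) +_) (count-map p f xs)

  count-cong : ∀ {p q : A → Bool} xs → (∀ x → p x ≡ q x) → count p xs ≡ count q xs
  count-cong []       p≗q = refl
  count-cong (x ∷ xs) p≗q = cong₂ _+_ (cong indicator (p≗q x)) (count-cong xs p≗q)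

  count-false : ∀ xs → count (λ (_ : A) → false) xs ≡ 0
  count-false []       = refl
  count-false (x ∷ xs) = count-false xs

  count-guard : ∀ g (p : A → Bool) xs → count (λ x → g ∧ p x) xs ≡ (if g then count p xs else 0)
  count-guard true  p xs = refl
  count-guard false p xs = count-false xs

  length-filterᵇ : ∀ (p : A → Bool) xs → length (filterᵇ p xs) ≡ count p xs
  length-filterᵇ p []       = refl
  length-filterᵇ p (x ∷ xs) with p x
  ... | true  = cong suc (length-filterᵇ p xs)
  ... | false = length-filterᵇ p xs

  indicator-≤ᵇ : ∀ g a D (p : ℕ → Bool) →
    indicator (g ∧ (a ≤ᵇ D) ∧ p a) ≡ ∑[ k ≤ D ] indicator (g ∧ (a ≡ᵇ k) ∧ p k)
  indicator-≤ᵇ false a       D       p = sym (∑≤-zero D λ _ → refl)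
  indicator-≤ᵇ true  zero    zero    p = refl
  indicator-≤ᵇ true  zero    (suc D) p = sym (cong (indicator (p 0) +_) (∑≤-zero D λ _ → refl) ⟨ trans ⟩ +-identityʳ _)
  indicator-≤ᵇ true  (suc a) zero    p = refl
  indicator-≤ᵇ true  (suc a) (suc D) p =
    cong (λ b → indicator (b ∧ p (suc a))) (≤ᵇ-suc a D) ⟨ trans ⟩ indicator-≤ᵇ true a D (p ∘ suc)
    where
    ≤ᵇ-suc : ∀ a D → (suc a ≤ᵇ suc D) ≡ (a ≤ᵇ D)
    ≤ᵇ-suc zero    D = refl
    ≤ᵇ-suc (suc a) D = refl

  count-partition : ∀ (g : A → Bool) (h : A → ℕ) (p : ℕ → A → Bool) D xs →
    count (λ x → g x ∧ (h x ≤ᵇ D) ∧ p (h x) x) xs ≡ ∑[ k ≤ D ] count (λ x → g x ∧ (h x ≡ᵇ k) ∧ p k x) xs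
  count-partition g h p D []       = sym (∑≤-zero D λ _ → refl)
  count-partition g h p D (x ∷ xs) =
    cong₂ _+_ (indicator-≤ᵇ (g x) (h x) D (λ k → p k x)) (count-partition g h p D xs) ⟨ trans ⟩
    sym (∑≤-distrib-+ D _ _)

-- Entry x of a status vector describes the value x + 1 of a candidate pinnacle set P of
-- ℤ_(t+1) ≀ S_n: plain if no ξ^a(x + 1) lies in P, low if ξ^t(x + 1) ∈ P (the lowest colour
-- class), high c if ξ^c(x + 1) ∈ P for some c < t.
data Status (t : ℕ) : Set where
  plain low : Status t
  high      : Fin t → Status t

module _ {t : ℕ} where

  #plain #low #high : ∀ {n} → Vec (Status t) n → ℕ
  #plain []          = 0
  #plain (plain ∷ c) = suc (#plain c)
  #plain (_     ∷ c) = #plain c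
  #low []            = 0
  #low (low ∷ c)     = suc (#low c)
  #low (_   ∷ c)     = #low c
  #high []           = 0
  #high (high _ ∷ c) = suc (#high c)
  #high (_      ∷ c) = #high c

  #plain+#high+#low : ∀ {n} (c : Vec (Status t) n) → #plain c + (#high c + #low c) ≡ n
  #plain+#high+#low []         = refl
  #plain+#high+#low (plain ∷ c) = cong suc (#plain+#high+#low c)
  #plain+#high+#low (low ∷ c)   =
    cong (#plain c +_) (+-suc (#high c) (#low c)) ⟨ trans ⟩ +-suc (#plain c) _ ⟨ trans ⟩ cong suc (#plain+#high+#low c)
  #plain+#high+#low (high _ ∷ c) = +-suc (#plain c) _ ⟨ trans ⟩ cong suc (#plain+#high+#low c)

  -- Since ξ^t(y) ≺ ξ^t(x) for y > x, the entries after a low entry are the values below it in the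
  -- lowest colour class; there must be two more plain than low ones among them.
  ballotᵇ : ∀ {n} → Vec (Status t) n → Bool
  ballotᵇ []        = true
  ballotᵇ (low ∷ c) = (suc (suc (#low c)) ≤ᵇ #plain c) ∧ ballotᵇ c
  ballotᵇ (_   ∷ c) = ballotᵇ c

  admissibleᵇ : ∀ {n} → Vec (Status t) n → Bool
  admissibleᵇ {n} c = (#high c ≤ᵇ d) ∧ (#low c ≤ᵇ d ∸ #high c) ∧ ballotᵇ c
    where d = halfFloor n

  hasShape : ∀ {n} → ℕ → ℕ → Vec (Status t) n → Bool
  hasShape k l c = (#high c ≡ᵇ k) ∧ (#low c ≡ᵇ l) ∧ ballotᵇ c

allStatuses : ∀ t → List (Status t)
allStatuses t = plain ∷ low ∷ map high (allFin t)

allStatusVectors : ∀ t n → List (Vec (Status t) n)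
allStatusVectors t zero    = [] ∷ []
allStatusVectors t (suc n) = cartesianProductWith _∷_ (allStatuses t) (allStatusVectors t n)

count-allStatusVectors-suc : ∀ {t n} (p : Vec (Status t) (suc n) → Bool) (q : Vec (Status t) n → Bool) →
  (∀ c r → p (high c ∷ r) ≡ q r) →
  count p (allStatusVectors t (suc n)) ≡
    count (p ∘ (plain ∷_)) (allStatusVectors t n) + (count (p ∘ (low ∷_)) (allStatusVectors t n)
                                                     + t * count q (allStatusVectors t n))
count-allStatusVectors-suc {t} {n} p q p≗q =
  count-++ p (map (plain ∷_) V) _ ⟨ trans ⟩
  cong₂ _+_ (count-map p (plain ∷_) V)
    (count-++ p (map (low ∷_) V) _ ⟨ trans ⟩
     cong₂ _+_ (count-map p (low ∷_) V)
               (highs (allFin t) ⟨ trans ⟩ cong (_* count q V) (Lₚ.length-tabulate {n = t} id)))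
  where
  V = allStatusVectors t n
  highs : ∀ cs → count p (cartesianProductWith _∷_ (map high cs) V) ≡ length cs * count q V
  highs []       = refl
  highs (c ∷ cs) = count-++ p (map (high c ∷_) V) _ ⟨ trans ⟩
                   cong₂ _+_ (count-map p (high c ∷_) V ⟨ trans ⟩ count-cong V (p≗q c)) (highs cs)

allStatuses-unique : ∀ t → Unique (allStatuses t)
allStatuses-unique t =
  ((λ ()) ∷ Allₚ.map⁺ (All.universal (λ _ ()) (L.allFin t))) ∷
  Allₚ.map⁺ (All.universal (λ _ ()) (L.allFin t)) ∷
  Uniqueₚ.map⁺ (λ { refl → refl }) (Uniqueₚ.allFin⁺ t)

allStatusVectors-unique : ∀ t n → Unique (allStatusVectors t n)
allStatusVectors-unique t zero    = [] ∷ []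
allStatusVectors-unique t (suc n) =
  Uniqueₚ.cartesianProductWith⁺ _∷_ Vₚ.∷-injective (allStatuses-unique t) (allStatusVectors-unique t n)

∈-allStatuses : ∀ {t} (s : Status t) → s ∈ allStatuses t
∈-allStatuses plain    = here refl
∈-allStatuses low      = there (here refl)
∈-allStatuses (high c) = there (there (∈-map⁺ high (∈-tabulate⁺ c)))

∈-allStatusVectors : ∀ {t n} (c : Vec (Status t) n) → c ∈ allStatusVectors t n
∈-allStatusVectors []      = here refl
∈-allStatusVectors (s ∷ c) = ∈-cartesianProductWith⁺ _∷_ (∈-allStatuses s) (∈-allStatusVectors c)

double≡*2 : ∀ x → x + x ≡ x * 2
double≡*2 x = cong (x +_) (sym (+-identityʳ x)) ⟨ trans ⟩ *-comm 2 x

halfFloor-double : ∀ n → 1 ≤ n → suc (halfFloor n + halfFloor n) ≤ n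
halfFloor-double (suc n) _ = s≤s (≤-reflexive (double≡*2 (n / 2)) ⟨ ≤-trans ⟩ m/n*n≤m n 2)

≤-halfFloor : ∀ {n} K → suc (K + K) ≤ n → K ≤ halfFloor n
≤-halfFloor {suc n} K (s≤s 2K≤n) =
  ≤-reflexive (sym (m*n/n≡m K 2)) ⟨ ≤-trans ⟩ /-monoˡ-≤ 2 (≤-reflexive (sym (double≡*2 K)) ⟨ ≤-trans ⟩ 2K≤n)

⇔⇒≤ᵇ≡ : ∀ {a b c d} → (a ≤ b ⇔ c ≤ d) → (a ≤ᵇ b) ≡ (c ≤ᵇ d)
⇔⇒≤ᵇ≡ {a} {b} {c} {d} a≤b⇔c≤d =
  det (≤ᵇ-reflects-≤ a b) (fromEquivalence (Equivalence.from a≤b⇔c≤d ∘ ≤ᵇ⇒≤ c d) (≤⇒≤ᵇ ∘ Equivalence.to a≤b⇔c≤d))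

suc≤∸⇔+≤ : ∀ m n o → (suc m ≤ o ∸ n) ⇔ (suc m + n ≤ o)
suc≤∸⇔+≤ m n o = mk⇔ (λ h → m≤o∸n⇒m+n≤o (suc m) (n≤o h) h) (m+n≤o⇒m≤o∸n (suc m))
  where
  n≤o : suc m ≤ o ∸ n → n ≤ o
  n≤o h = <⇒≤ (m∸n≢0⇒n<m λ o∸n≡0 → contradiction (subst (suc m ≤_) o∸n≡0 h) λ ())

hasShape-low : ∀ {t n} k l (r : Vec (Status t) n) →
  hasShape k (suc l) (low ∷ r) ≡ (suc (suc (l + l)) ≤ᵇ n ∸ k) ∧ hasShape k l r
hasShape-low {n = n} k l r with #high r ≡ᵇ k | ≡ᵇ⇒≡ (#high r) k
... | false | _ = sym (∧-zeroʳ _)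
... | true  | #high≡k with #low r ≡ᵇ l | ≡ᵇ⇒≡ (#low r) l
...   | false | _ = sym (∧-zeroʳ _)
...   | true  | #low≡l = cong (_∧ ballotᵇ r)
  (⇔⇒≤ᵇ≡ (subst (λ p → (suc (suc (#low r)) ≤ p) ⇔ (suc (suc (#low r + #low r)) ≤ n ∸ k)) (sym #plain≡)
                (suc≤∸⇔+≤ (suc (#low r)) (#low r) (n ∸ k))) ⟨ trans ⟩
   cong (λ x → suc (suc (x + x)) ≤ᵇ n ∸ k) (#low≡l _))
  where
  #plain≡ : #plain r ≡ n ∸ k ∸ #low r
  #plain≡ = begin
    #plain r
      ≡⟨ sym (m+n∸n≡m (#plain r) (#high r + #low r)) ⟩
    #plain r + (#high r + #low r) ∸ (#high r + #low r)
      ≡⟨ cong₂ _∸_ (#plain+#high+#low r) (cong (_+ #low r) (#high≡k _)) ⟩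
    n ∸ (k + #low r)
      ≡⟨ sym (∸-+-assoc n k (#low r)) ⟩
    n ∸ k ∸ #low r ∎
    where open ≡-Reasoning

highHeaded : ℕ → ℕ → ℕ → ℕ → ℕ
highHeaded t n zero    l = 0
highHeaded t n (suc k) l = t * (t ^ k * (n C k) * ballotNumber (n ∸ k) l)

-- The number of vectors of shape (k, l) and length suc n whose head is plain, low or high,
-- respectively, added up.
headSplit : ℕ → ℕ → ℕ → ℕ → ℕ
headSplit t n k l =
  t ^ k * (n C k) * ballotNumber (n ∸ k) l + (t ^ k * (n C k) * ballotNumberLowHead (n ∸ k) l + highHeaded t n k l)

headSplit-below : ∀ t n k l → suc k ≤ n → headSplit t n (suc k) l ≡ t ^ suc k * (suc n C suc k) * ballotNumber (n ∸ k) l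
headSplit-below t n k l k<n = begin
  t * p * b * β N l + (t * p * b * h N l + t * (p * a * β (n ∸ k) l))
    ≡⟨ cong (λ x → t * p * b * β N l + (t * p * b * h N l + t * (p * a * β x l))) n∸k≡1+N ⟩
  t * p * b * β N l + (t * p * b * h N l + t * (p * a * (β N l + h N l)))
    ≡⟨ solve 6 (λ t p a b β h → t :* p :* b :* β :+ (t :* p :* b :* h :+ t :* (p :* a :* (β :+ h)))
                                := t :* p :* (a :+ b) :* (β :+ h))
               refl t p a b (β N l) (h N l) ⟩
  t * p * (a + b) * β (suc N) l
    ≡⟨ cong₂ (λ c x → t * p * c * β x l) (nCk+nC[k+1]≡[n+1]C[k+1] n k) (sym n∸k≡1+N) ⟩
  t * p * (suc n C suc k) * β (n ∸ k) l ∎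
  where
  open ≡-Reasoning
  open ℕ-Solver.+-*-Solver
  β = ballotNumber
  h = ballotNumberLowHead
  p = t ^ k
  a = n C k
  b = n C suc k
  N = n ∸ suc k
  n∸k≡1+N : n ∸ k ≡ suc N
  n∸k≡1+N = +-∸-assoc 1 k<n

headSplit-beyond : ∀ t n k l → n ≤ k → headSplit t n (suc k) l ≡ t ^ suc k * (suc n C suc k) * ballotNumber (n ∸ k) l
headSplit-beyond t n k l n≤k = begin
  t * p * b * β + (t * p * b * h + t * (p * a * β′))
    ≡⟨ cong (λ b → t * p * b * β + (t * p * b * h + t * (p * a * β′))) b≡0 ⟩
  t * p * 0 * β + (t * p * 0 * h + t * (p * a * β′))
    ≡⟨ solve 6 (λ t p a β h β′ → t :* p :* con 0 :* β :+ (t :* p :* con 0 :* h :+ t :* (p :* a :* β′))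
                                 := t :* p :* (a :+ con 0) :* β′)
               refl t p a β h β′ ⟩
  t * p * (a + 0) * β′
    ≡⟨ cong (λ c → t * p * c * β′) (cong (a +_) (sym b≡0) ⟨ trans ⟩ nCk+nC[k+1]≡[n+1]C[k+1] n k) ⟩
  t * p * (suc n C suc k) * β′ ∎
  where
  open ≡-Reasoning
  open ℕ-Solver.+-*-Solver
  p = t ^ k
  a = n C k
  b = n C suc k
  β = ballotNumber (n ∸ suc k) l
  h = ballotNumberLowHead (n ∸ suc k) l
  β′ = ballotNumber (n ∸ k) l
  b≡0 : b ≡ 0
  b≡0 = k>n⇒nCk≡0 (s≤s n≤k)

headSplit≡ : ∀ t n k l → headSplit t n k l ≡ t ^ k * (suc n C k) * ballotNumber (suc n ∸ k) l
headSplit≡ t n zero l =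
  solve 2 (λ β h → con 1 :* con 1 :* β :+ (con 1 :* con 1 :* h :+ con 0) := con 1 :* con 1 :* (β :+ h))
        refl (ballotNumber n l) (ballotNumberLowHead n l)
  where open ℕ-Solver.+-*-Solver
headSplit≡ t n (suc k) l with suc k ≤? n
... | yes k<n = headSplit-below t n k l k<n
... | no  k≮n = headSplit-beyond t n k l (≤-pred (≰⇒> k≮n))

count-hasShape : ∀ t n k l → count (hasShape k l) (allStatusVectors t n) ≡ t ^ k * (n C k) * ballotNumber (n ∸ k) l
count-hasShape t zero    zero    zero    = refl
count-hasShape t zero    zero    (suc l) = refl
count-hasShape t zero    (suc k) l       = sym (cong (_* ballotNumber 0 l) (*-zeroʳ (t ^ suc k)))
count-hasShape t (suc n) k       l       =
  count-allStatusVectors-suc (hasShape k l) (highTail k) (λ c r → highTail-head k {c} {r}) ⟨ trans ⟩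
  cong₂ _+_ (count-hasShape t n k l) (cong₂ _+_ (lowHeaded l) (highHeaded≡ k)) ⟨ trans ⟩
  headSplit≡ t n k l
  where
  V = allStatusVectors t n
  X = t ^ k * (n C k)
  highTail : ℕ → Vec (Status t) n → Bool
  highTail zero    _ = false
  highTail (suc k) r = hasShape k l r
  highTail-head : ∀ k {c r} → hasShape k l (high c ∷ r) ≡ highTail k r
  highTail-head zero    = refl
  highTail-head (suc k) = refl
  lowHeaded : ∀ l → count (hasShape k l ∘ (low ∷_)) V ≡ X * ballotNumberLowHead (n ∸ k) l
  lowHeaded zero    = count-cong V (λ r → ∧-zeroʳ (#high r ≡ᵇ k)) ⟨ trans ⟩ count-false V ⟨ trans ⟩ sym (*-zeroʳ X)
  lowHeaded (suc l) =
    count-cong V (hasShape-low k l) ⟨ trans ⟩ count-guard _ (hasShape k l) V ⟨ trans ⟩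
    cong (λ x → if suc (suc (l + l)) ≤ᵇ n ∸ k then x else 0) (count-hasShape t n k l) ⟨ trans ⟩
    if-*ʳ (suc (suc (l + l)) ≤ᵇ n ∸ k) X _
  highHeaded≡ : ∀ k → t * count (highTail k) V ≡ highHeaded t n k l
  highHeaded≡ zero    = cong (t *_) (count-false V) ⟨ trans ⟩ *-zeroʳ t
  highHeaded≡ (suc k) = cong (t *_) (count-hasShape t n k l)

count-admissible : ∀ t n → 1 ≤ n → count admissibleᵇ (allStatusVectors t n) ≡ closedForm t n (halfFloor n)
count-admissible t n 1≤n =
  count-partition (λ _ → true) #high (λ k c → (#low c ≤ᵇ d ∸ k) ∧ ballotᵇ c) d V ⟨ trans ⟩
  ∑≤-cong d byShape
  where
  open ≡-Reasoning
  d = halfFloor n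
  V = allStatusVectors t n
  room : ∀ {k} → k ≤ d → suc ((d ∸ k) + (d ∸ k)) ≤ n ∸ k
  room {k} k≤d = m+n≤o⇒m≤o∸n (suc ((d ∸ k) + (d ∸ k)))
    (≤-reflexive (cong suc (+-assoc (d ∸ k) (d ∸ k) k ⟨ trans ⟩ cong ((d ∸ k) +_) (m∸n+n≡m k≤d))) ⟨ ≤-trans ⟩
     s≤s (+-monoˡ-≤ d (m∸n≤m d k)) ⟨ ≤-trans ⟩ halfFloor-double n 1≤n)
  byShape : ∀ {k} → k ≤ d → count (λ c → (#high c ≡ᵇ k) ∧ (#low c ≤ᵇ d ∸ k) ∧ ballotᵇ c) V ≡ binomialTerm t n d k
  byShape {k} k≤d = begin
    count (λ c → (#high c ≡ᵇ k) ∧ (#low c ≤ᵇ d ∸ k) ∧ ballotᵇ c) V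
      ≡⟨ count-partition (λ c → #high c ≡ᵇ k) #low (λ _ → ballotᵇ) (d ∸ k) V ⟩
    ∑[ l ≤ d ∸ k ] count (hasShape k l) V
      ≡⟨ ∑≤-cong (d ∸ k) (λ {l} _ → count-hasShape t n k l) ⟩
    ∑[ l ≤ d ∸ k ] (t ^ k * (n C k) * ballotNumber (n ∸ k) l)
      ≡⟨ sym (*-distribˡ-∑≤ (d ∸ k) (t ^ k * (n C k)) (ballotNumber (n ∸ k))) ⟩
    t ^ k * (n C k) * ∑≤ (d ∸ k) (ballotNumber (n ∸ k))
      ≡⟨ cong (t ^ k * (n C k) *_) (∑-ballotNumber (n ∸ k) (d ∸ k) (room k≤d)) ⟩
    binomialTerm t n d k ∎

-- The order on 𝕀 and the encoding of status vectors

≺-asym : ∀ {m n} {e e′ : El m n} → e ≺ e′ → e′ ≺ e → ⊥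
≺-asym (inj₁ b<a)          (inj₁ a<b)         = <-asym b<a a<b
≺-asym (inj₁ b<a)          (inj₂ (refl , _))  = <-irrefl refl b<a
≺-asym (inj₂ (refl , _))   (inj₁ a<b)         = <-irrefl refl a<b
≺-asym (inj₂ (refl , y<x)) (inj₂ (_ , x<y))   = <-asym y<x x<y

≺-trans : ∀ {m n} {e₁ e₂ e₃ : El m n} → e₁ ≺ e₂ → e₂ ≺ e₃ → e₁ ≺ e₃
≺-trans (inj₁ p)          (inj₁ q)          = inj₁ (<-trans q p)
≺-trans (inj₁ p)          (inj₂ (refl , _)) = inj₁ p
≺-trans (inj₂ (refl , _)) (inj₁ q)          = inj₁ q
≺-trans (inj₂ (refl , p)) (inj₂ (refl , q)) = inj₂ (refl , <-trans q p)

-- The colour ξ^t, whose elements are the lowest ones of 𝕀ⁿ_(t+1).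
lowest : ∀ {t} → Fin (suc t)
lowest {t} = fromℕ t

¬lowest< : ∀ {t} (a : Fin (suc t)) → ¬ (lowest F.< a)
¬lowest<  {t} a lowest<a =
  <-irrefl refl (<-≤-trans (subst (_< toℕ a) (toℕ-fromℕ t) lowest<a) (≤-pred (toℕ<n a)))

lowest≺high : ∀ {t n} (c : Fin t) (x y : Fin n) → (lowest , x) ≺ (inject₁ c , y)
lowest≺high {t} c x y = inj₁ (subst₂ _<_ (sym (toℕ-inject₁ c)) (sym (toℕ-fromℕ t)) (toℕ<n c))

does-true : ∀ {P : Set} (P? : Dec P) → does P? ≡ true → P
does-true (yes p) _ = p

∧-true : ∀ {a b} → a ∧ b ≡ true → (a ≡ true) × (b ≡ true)
∧-true {true} {true} _ = refl , refl

colourOf : ∀ {t} → Status t → Fin (suc t)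
colourOf (high c) = inject₁ c
colourOf _        = lowest

isIn : ∀ {t} → Fin (suc t) → Status t → Bool
isIn a plain    = false
isIn a low      = does (a ≟ lowest)
isIn a (high c) = does (a ≟ inject₁ c)

isIn-injective : ∀ {t} (s s′ : Status t) → (∀ a → isIn a s ≡ isIn a s′) → s ≡ s′
isIn-injective plain    plain     _ = refl
isIn-injective low      low       _ = refl
isIn-injective {t} plain low h = contradiction (h lowest ⟨ trans ⟩ dec-true (lowest {t} ≟ lowest) refl) λ ()
isIn-injective plain    (high c′) h =
  contradiction (h (inject₁ c′) ⟨ trans ⟩ dec-true (inject₁ c′ ≟ inject₁ c′) refl) λ ()
isIn-injective low      plain     h = sym (isIn-injective plain low (sym ∘ h))
isIn-injective (high c) plain     h = sym (isIn-injective plain (high c) (sym ∘ h))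
isIn-injective {t} low (high c′) h =
  contradiction (sym (dec-true (lowest {t} ≟ lowest) refl) ⟨ trans ⟩ h lowest ⟨ trans ⟩
                 dec-false (lowest ≟ inject₁ c′) fromℕ≢inject₁) λ ()
isIn-injective (high c) low       h = sym (isIn-injective low (high c) (sym ∘ h))
isIn-injective (high c) (high c′) h =
  cong high (inject₁-injective (does-true (inject₁ c ≟ inject₁ c′)
    (sym (h (inject₁ c)) ⟨ trans ⟩ dec-true (inject₁ c ≟ inject₁ c) refl)))

encode : ∀ {t n} → Vec (Status t) n → SubsetI (suc t) n
encode c = V.tabulate (λ a → V.map (isIn a) c)

lookup-encode : ∀ {t n} (c : Vec (Status t) n) a x → V.lookup (V.lookup (encode c) a) x ≡ isIn a (V.lookup c x)
lookup-encode c a x =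
  cong (λ col → V.lookup col x) (lookup∘tabulate (λ a → V.map (isIn a) c) a) ⟨ trans ⟩ lookup-map x (isIn a) c

vec-ext : ∀ {A : Set} {k} {u v : Vec A k} → (∀ i → V.lookup u i ≡ V.lookup v i) → u ≡ v
vec-ext {u = u} {v} u≗v = sym (tabulate∘lookup u) ⟨ trans ⟩ tabulate-cong u≗v ⟨ trans ⟩ tabulate∘lookup v

encode-injective : ∀ {t n} {c c′ : Vec (Status t) n} → encode c ≡ encode c′ → c ≡ c′
encode-injective {c = c} {c′} eq = vec-ext λ x → isIn-injective _ _ λ a →
  sym (lookup-encode c a x) ⟨ trans ⟩ cong (λ P → V.lookup (V.lookup P a) x) eq ⟨ trans ⟩ lookup-encode c′ a x

statusOfColour : ∀ {t} → Fin (suc t) → Status t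
statusOfColour {t} a with a ≟ lowest
... | yes _        = low
... | no a≢lowest = high (F.lower₁ a λ t≡a → a≢lowest (Fₚ.toℕ-injective (sym t≡a ⟨ trans ⟩ sym (toℕ-fromℕ t))))

isIn-statusOfColour : ∀ {t} (b a : Fin (suc t)) → isIn b (statusOfColour a) ≡ does (b ≟ a)
isIn-statusOfColour b a with a ≟ lowest
... | yes refl = refl
... | no _     = cong (λ c → does (b ≟ c)) (Fₚ.inject₁-lower₁ a _)

isIn-colourOf : ∀ {t} (s : Status t) → s ≢ plain → isIn (colourOf s) s ≡ true
isIn-colourOf plain    s≢plain = contradiction refl s≢plain
isIn-colourOf {t} low _      = dec-true (lowest {t} ≟ lowest) refl
isIn-colourOf (high c) _       = dec-true (inject₁ c ≟ inject₁ c) refl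

countFin : ∀ n → (Fin n → Bool) → ℕ
countFin zero    f = 0
countFin (suc n) f = indicator (f F.zero) + countFin n (f ∘ F.suc)

countFin-cong : ∀ n {f g : Fin n → Bool} → (∀ i → f i ≡ g i) → countFin n f ≡ countFin n g
countFin-cong zero    f≗g = refl
countFin-cong (suc n) f≗g = cong₂ _+_ (cong indicator (f≗g F.zero)) (countFin-cong n (f≗g ∘ F.suc))

countFin-none : ∀ n {f : Fin n → Bool} → (∀ i → f i ≡ false) → countFin n f ≡ 0
countFin-none n f≗false = countFin-cong n f≗false ⟨ trans ⟩ none n
  where
  none : ∀ n → countFin n (λ _ → false) ≡ 0
  none zero    = refl
  none (suc n) = none n

countFin-complement : ∀ n (f : Fin n → Bool) → countFin n f + countFin n (not ∘ f) ≡ n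
countFin-complement zero    f = refl
countFin-complement (suc n) f with f F.zero
... | true  = cong suc (countFin-complement n (f ∘ F.suc))
... | false = +-suc (countFin n (f ∘ F.suc)) _ ⟨ trans ⟩ cong suc (countFin-complement n (f ∘ F.suc))

countFin-remove : ∀ n (f : Fin n → Bool) k → f k ≡ true →
  countFin n f ≡ suc (countFin n (λ i → f i ∧ not (does (i ≟ k))))
countFin-remove (suc n) f F.zero    fk =
  cong (λ b → indicator b + countFin n (f ∘ F.suc)) fk ⟨ trans ⟩
  cong suc (cong₂ _+_ (cong indicator (sym (∧-zeroʳ (f F.zero))))
                     (countFin-cong n λ i → sym (∧-identityʳ (f (F.suc i)))))
countFin-remove (suc n) f (F.suc k) fk =
  cong (indicator (f F.zero) +_) (countFin-remove n (f ∘ F.suc) k fk) ⟨ trans ⟩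
  +-suc (indicator (f F.zero)) _ ⟨ trans ⟩
  cong (λ b → suc (indicator b + countFin n (λ i → f (F.suc i) ∧ not (does (i ≟ k))))) (sym (∧-identityʳ (f F.zero)))

countFin-injection : ∀ a b (P : Fin a → Bool) (Q : Fin b → Bool) (g : Fin a → Fin b) →
  (∀ i → P i ≡ true → Q (g i) ≡ true) →
  (∀ i j → P i ≡ true → P j ≡ true → g i ≡ g j → i ≡ j) → countFin a P ≤ countFin b Q
countFin-injection zero    b P Q g P⇒Q g-inj = z≤n
countFin-injection (suc a) b P Q g P⇒Q g-inj with P F.zero in P0
... | false = countFin-injection a b (P ∘ F.suc) Q (g ∘ F.suc) (P⇒Q ∘ F.suc)
                (λ i j Pi Pj eq → Fₚ.suc-injective (g-inj (F.suc i) (F.suc j) Pi Pj eq))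
... | true  = s≤s (countFin-injection a b (P ∘ F.suc) Q′ (g ∘ F.suc) P⇒Q′ g-inj′) ⟨ ≤-trans ⟩
              ≤-reflexive (sym (countFin-remove b Q (g F.zero) (P⇒Q F.zero P0)))
  where
  Q′ : Fin b → Bool
  Q′ y = Q y ∧ not (does (y ≟ g F.zero))
  P⇒Q′ : ∀ i → P (F.suc i) ≡ true → Q′ (g (F.suc i)) ≡ true
  P⇒Q′ i Pi = cong₂ (λ q d → q ∧ not d) (P⇒Q (F.suc i) Pi)
                   (dec-false (g (F.suc i) ≟ g F.zero) λ eq → contradiction (g-inj (F.suc i) F.zero Pi P0 eq) λ ())
  g-inj′ : ∀ i j → P (F.suc i) ≡ true → P (F.suc j) ≡ true → g (F.suc i) ≡ g (F.suc j) → i ≡ j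
  g-inj′ i j Pi Pj eq = Fₚ.suc-injective (g-inj (F.suc i) (F.suc j) Pi Pj eq)

isPlain isLow : ∀ {t} → Status t → Bool
isPlain plain = true
isPlain _     = false
isLow low = true
isLow _   = false

module _ {t : ℕ} where

  #plain≡countFin : ∀ {n} (c : Vec (Status t) n) → #plain c ≡ countFin n (isPlain ∘ V.lookup c)
  #plain≡countFin []           = refl
  #plain≡countFin (plain  ∷ c) = cong suc (#plain≡countFin c)
  #plain≡countFin (low    ∷ c) = #plain≡countFin c
  #plain≡countFin (high _ ∷ c) = #plain≡countFin c

  #low≡countFin : ∀ {n} (c : Vec (Status t) n) → #low c ≡ countFin n (isLow ∘ V.lookup c)
  #low≡countFin []           = refl
  #low≡countFin (plain  ∷ c) = #low≡countFin c
  #low≡countFin (low    ∷ c) = cong suc (#low≡countFin c)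
  #low≡countFin (high _ ∷ c) = #low≡countFin c

  #high+#low≡countFin : ∀ {n} (c : Vec (Status t) n) → #high c + #low c ≡ countFin n (not ∘ isPlain ∘ V.lookup c)
  #high+#low≡countFin {n} c = +-cancelˡ-≡ (#plain c) _ _ (#plain+#high+#low c ⟨ trans ⟩
    sym (cong (_+ countFin n (not ∘ isPlain ∘ V.lookup c)) (#plain≡countFin c) ⟨ trans ⟩
         countFin-complement n (isPlain ∘ V.lookup c)))

  countAbove : ∀ {n} → (Status t → Bool) → Vec (Status t) n → Fin n → ℕ
  countAbove {n} p c x = countFin n (λ y → does (x F.<? y) ∧ p (V.lookup c y))

  ballotᵇ-intro : ∀ {n} (c : Vec (Status t) n) →
    (∀ x → V.lookup c x ≡ low → suc (suc (countAbove isLow c x)) ≤ countAbove isPlain c x) → ballotᵇ c ≡ true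
  ballotᵇ-intro []           _     = refl
  ballotᵇ-intro (plain  ∷ c) ballot = ballotᵇ-intro c (ballot ∘ F.suc)
  ballotᵇ-intro (high _ ∷ c) ballot = ballotᵇ-intro c (ballot ∘ F.suc)
  ballotᵇ-intro (low    ∷ c) ballot =
    cong₂ _∧_ (≤⇒≤ᵇ≡true (subst₂ (λ l p → suc (suc l) ≤ p) (sym (#low≡countFin c)) (sym (#plain≡countFin c))
                                                  (ballot F.zero refl)))
              (ballotᵇ-intro c (ballot ∘ F.suc))

isHigh : ∀ {t} → Status t → Bool
isHigh (high _) = true
isHigh _        = false

#high≡countFin : ∀ {t n} (c : Vec (Status t) n) → #high c ≡ countFin n (isHigh ∘ V.lookup c)
#high≡countFin []           = refl
#high≡countFin (plain  ∷ c) = #high≡countFin c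
#high≡countFin (low    ∷ c) = #high≡countFin c
#high≡countFin (high _ ∷ c) = cong suc (#high≡countFin c)

-- Peaks and feet

_!?_ : {A : Set} → List A → ℕ → Maybe A
[]       !? _     = nothing
(x ∷ xs) !? zero  = just x
(x ∷ xs) !? suc i = xs !? i

tabulate-!? : ∀ {A : Set} {n} (f : Fin n → A) (p : Fin n) → L.tabulate f !? toℕ p ≡ just (f p)
tabulate-!? {n = suc n} f F.zero    = refl
tabulate-!? {n = suc n} f (F.suc p) = tabulate-!? (f ∘ F.suc) p

tabulate-!?⁻ : ∀ {A : Set} {n} (f : Fin n → A) i {e} → L.tabulate f !? i ≡ just e → Σ (Fin n) λ p → toℕ p ≡ i × f p ≡ e
tabulate-!?⁻ {n = suc n} f zero    refl = F.zero , refl , refl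
tabulate-!?⁻ {n = suc n} f (suc i) h with tabulate-!?⁻ (f ∘ F.suc) i h
... | p , p≡i , fp≡e = F.suc p , cong suc p≡i , fp≡e

map-!? : ∀ {A B : Set} (f : A → B) (xs : List A) i → map f xs !? i ≡ M.map f (xs !? i)
map-!? f []       i       = refl
map-!? f (x ∷ xs) zero    = refl
map-!? f (x ∷ xs) (suc i) = map-!? f xs i

count-tabulate : ∀ {A : Set} n (p : A → Bool) (f : Fin n → A) → count p (L.tabulate f) ≡ countFin n (p ∘ f)
count-tabulate zero    p f = refl
count-tabulate (suc n) p f = cong (indicator (p (f F.zero)) +_) (count-tabulate n p (f ∘ F.suc))

data Mark : Set where
  peak foot other : Mark

isPeak isFoot : Mark → Bool
isPeak peak = true
isPeak _    = false
isFoot foot = true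
isFoot _    = false

-- b tells whether the entry just before the list is a foot.
FootBefore : Bool → List Mark → ℕ → Set
FootBefore b ms zero    = b ≡ true
FootBefore b ms (suc i) = ms !? i ≡ just foot

PeaksFlanked : Bool → List Mark → Set
PeaksFlanked b ms = ∀ i → ms !? i ≡ just peak → FootBefore b ms i × (ms !? suc i ≡ just foot)

any-peak : ∀ ms i → ms !? i ≡ just peak → any isPeak ms ≡ true
any-peak (peak ∷ ms) zero    _ = refl
any-peak (peak ∷ ms) (suc i) _ = refl
any-peak (foot ∷ ms) (suc i) h = any-peak ms i h
any-peak (other ∷ ms) (suc i) h = any-peak ms i h

count-peak-none : ∀ ms → any isPeak ms ≡ false → count isPeak ms ≡ 0
count-peak-none []           _ = refl
count-peak-none (foot ∷ ms)  h = count-peak-none ms h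
count-peak-none (other ∷ ms) h = count-peak-none ms h

-- Each peak consumes the foot after it; the foot before the first peak is one more.
peaks<feet : ∀ b ms → PeaksFlanked b ms →
  count isPeak ms + indicator (any isPeak ms) ≤ count isFoot ms + indicator b
peaks<feet b []           flanked = z≤n
peaks<feet b (foot ∷ ms)  flanked =
  peaks<feet true ms (shift flanked) ⟨ ≤-trans ⟩ ≤-reflexive (+-comm (count isFoot ms) 1) ⟨ ≤-trans ⟩ m≤m+n _ _
  where
  shift : PeaksFlanked b (foot ∷ ms) → PeaksFlanked true ms
  shift fl zero    m = refl , proj₂ (fl 1 m)
  shift fl (suc i) m = fl (suc (suc i)) m
peaks<feet b (other ∷ ms) flanked =
  peaks<feet false ms (shift flanked) ⟨ ≤-trans ⟩ +-monoʳ-≤ (count isFoot ms) z≤n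
  where
  shift : PeaksFlanked b (other ∷ ms) → PeaksFlanked false ms
  shift fl zero    m with () ← proj₁ (fl 1 m)
  shift fl (suc i) m = fl (suc (suc i)) m
peaks<feet b (peak ∷ ms) flanked with flanked 0 refl
peaks<feet b (peak ∷ [])          flanked | _    , ()
peaks<feet b (peak ∷ peak ∷ ms)   flanked | _    , ()
peaks<feet b (peak ∷ other ∷ ms)  flanked | _    , ()
peaks<feet b (peak ∷ foot ∷ ms)   flanked | refl , _ = s≤s (+-monoˡ-≤ 1 peaks≤feet)
  where
  shift : PeaksFlanked true ms
  shift zero    m = refl , proj₂ (flanked 2 m)
  shift (suc i) m = flanked (suc (suc (suc i))) m
  peaks≤feet : count isPeak ms ≤ count isFoot ms
  peaks≤feet with any isPeak ms in anyPeak | peaks<feet true ms shift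
  ... | true  | ih = +-cancelʳ-≤ 1 _ _ ih
  ... | false | _  = ≤-reflexive (count-peak-none ms anyPeak) ⟨ ≤-trans ⟩ z≤n

-- The status vector of a pinnacle set

module StatusOfPinnacleSet {t n : ℕ} (π : ColPerm (suc t) n) (P : SubsetI (suc t) n) (P-pin : IsPinSet π P) where

  inP : El (suc t) n → Bool
  inP (a , x) = V.lookup (V.lookup P a) x

  inP⇒pinnacle : ∀ {e} → inP e ≡ true → IsPinnacle π e
  inP⇒pinnacle = Equivalence.to (P-pin _)

  w-injective : ∀ {p q} → w π p ≡ w π q → p ≡ q
  w-injective eq = σ-inj π (cong proj₂ eq)

  flanks : ∀ p → inP (w π p) ≡ true → Σ (Fin n) λ h → Σ (Fin n) λ j →
    (toℕ p ≡ suc (toℕ h)) × (toℕ j ≡ suc (toℕ p)) × (w π h ≺ w π p) × (w π j ≺ w π p)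
  flanks p p∈P with inP⇒pinnacle p∈P
  ... | h , i , j , i≡h+1 , j≡i+1 , wi≡wp , j≺i , h≺i with refl ← w-injective wi≡wp =
    h , j , i≡h+1 , j≡i+1 , h≺i , j≺i

  left-∉P : ∀ {h p} → toℕ p ≡ suc (toℕ h) → w π h ≺ w π p → inP (w π h) ≡ false
  left-∉P {h} {p} p≡h+1 h≺p = ¬-not λ h∈P → case flanks h h∈P of λ where
    (_ , j , _ , j≡h+1 , _ , j≺h) → case Fₚ.toℕ-injective (j≡h+1 ⟨ trans ⟩ sym p≡h+1) of λ where
      refl → ≺-asym h≺p j≺h

  right-∉P : ∀ {p j} → toℕ j ≡ suc (toℕ p) → w π j ≺ w π p → inP (w π j) ≡ false
  right-∉P {p} {j} j≡p+1 j≺p = ¬-not λ j∈P → case flanks j j∈P of λ where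
    (h , _ , j≡h+1 , _ , h≺j , _) →
      case Fₚ.toℕ-injective (suc-injective (sym j≡h+1 ⟨ trans ⟩ j≡p+1)) of λ where
      refl → ≺-asym j≺p h≺j

  one-colour : ∀ {a b x} → inP (a , x) ≡ true → inP (b , x) ≡ true → a ≡ b
  one-colour a∈P b∈P with inP⇒pinnacle a∈P | inP⇒pinnacle b∈P
  ... | _ , i , _ , _ , _ , wi , _ | _ , i′ , _ , _ , _ , wi′ , _
    with refl ← σ-inj π (cong proj₂ wi ⟨ trans ⟩ sym (cong proj₂ wi′)) =
    sym (cong proj₁ wi) ⟨ trans ⟩ cong proj₁ wi′

  posOf : Fin n → Fin n
  posOf y with Fₚ.any? (λ p → σ π p ≟ y)
  ... | yes (p , _) = p
  ... | no _        = y

  posOf-σ : ∀ p → posOf (σ π p) ≡ p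
  posOf-σ p with Fₚ.any? (λ q → σ π q ≟ σ π p)
  ... | yes (q , σq≡σp) = σ-inj π σq≡σp
  ... | no none         = ⊥-elim (none (p , refl))

  w-posOf : ∀ {e} → inP e ≡ true → w π (posOf (proj₂ e)) ≡ e
  w-posOf e∈P with inP⇒pinnacle e∈P
  ... | _ , i , _ , _ , _ , wi≡e , _ =
    cong (w π) (cong posOf (sym (cong proj₂ wi≡e)) ⟨ trans ⟩ posOf-σ i) ⟨ trans ⟩ wi≡e

  statusAt : Fin n → Status t
  statusAt x with Fₚ.any? (λ a → inP (a , x) Bₚ.≟ true)
  ... | yes (a , _) = statusOfColour a
  ... | no _        = plain

  isIn-statusAt : ∀ a x → isIn a (statusAt x) ≡ inP (a , x)
  isIn-statusAt a x with Fₚ.any? (λ a → inP (a , x) Bₚ.≟ true)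
  ... | no none = sym (¬-not λ a∈P → none (a , a∈P))
  ... | yes (b , b∈P) with a ≟ b
  ...   | yes refl = isIn-statusOfColour a a ⟨ trans ⟩ dec-true (a ≟ a) refl ⟨ trans ⟩ sym b∈P
  ...   | no a≢b   = isIn-statusOfColour a b ⟨ trans ⟩ dec-false (a ≟ b) a≢b ⟨ trans ⟩
                     sym (¬-not λ a∈P → a≢b (one-colour a∈P b∈P))

  statusVector : Vec (Status t) n
  statusVector = V.tabulate statusAt

  encode-statusVector : encode statusVector ≡ P
  encode-statusVector = vec-ext λ a → vec-ext λ x →
    lookup-encode statusVector a x ⟨ trans ⟩ cong (isIn a) (lookup∘tabulate statusAt x) ⟨ trans ⟩ isIn-statusAt a x

  statusAt-inP : ∀ y → statusAt y ≢ plain → inP (colourOf (statusAt y) , y) ≡ true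
  statusAt-inP y ≢plain = sym (isIn-statusAt _ y) ⟨ trans ⟩ isIn-colourOf (statusAt y) ≢plain

  statusAt-plain : ∀ y → (∀ a → inP (a , y) ≡ false) → statusAt y ≡ plain
  statusAt-plain y none = isIn-injective _ _ λ a → isIn-statusAt a y ⟨ trans ⟩ none a

  module Selection (sel : El (suc t) n → Bool)
                   (sel-down : ∀ {e e′} → e′ ≺ e → sel e ≡ true → sel e′ ≡ true) where

    mark : El (suc t) n → Mark
    mark e = if sel e then (if inP e then peak else foot) else other

    isPeak-mark : ∀ e → isPeak (mark e) ≡ sel e ∧ inP e
    isPeak-mark e with sel e | inP e
    ... | true  | true  = refl
    ... | true  | false = refl
    ... | false | _     = refl

    isFoot-mark : ∀ e → isFoot (mark e) ≡ sel e ∧ not (inP e)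
    isFoot-mark e with sel e | inP e
    ... | true  | true  = refl
    ... | true  | false = refl
    ... | false | _     = refl

    marks : List Mark
    marks = map mark (L.tabulate (w π))

    marks-!? : ∀ p → marks !? toℕ p ≡ just (mark (w π p))
    marks-!? p = map-!? mark (L.tabulate (w π)) (toℕ p) ⟨ trans ⟩ cong (M.map mark) (tabulate-!? (w π) p)

    peak-position : ∀ i → marks !? i ≡ just peak →
      Σ (Fin n) λ p → toℕ p ≡ i × sel (w π p) ≡ true × inP (w π p) ≡ true
    peak-position i mi≡peak with L.tabulate (w π) !? i in wi | map-!? mark (L.tabulate (w π)) i
    ... | nothing | mi≡nothing = case sym mi≡peak ⟨ trans ⟩ mi≡nothing of λ ()
    ... | just e  | mi≡mark with tabulate-!?⁻ (w π) i wi
    ...   | p , p≡i , refl =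
      p , p≡i , ∧-true (sym (isPeak-mark e) ⟨ trans ⟩ cong isPeak (just-injective (sym mi≡mark ⟨ trans ⟩ mi≡peak)))

    flanked : PeaksFlanked false marks
    flanked i mi≡peak with peak-position i mi≡peak
    ... | p , refl , sel-p , p∈P with flanks p p∈P
    ...   | h , j , p≡h+1 , j≡p+1 , h≺p , j≺p =
      subst (FootBefore false marks) (sym p≡h+1) (foot-at h h≺p (left-∉P p≡h+1 h≺p)) ,
      subst (λ k → marks !? k ≡ just foot) j≡p+1 (foot-at j j≺p (right-∉P j≡p+1 j≺p))
      where
      foot-at : ∀ q → w π q ≺ w π p → inP (w π q) ≡ false → marks !? toℕ q ≡ just foot
      foot-at q q≺p q∉P = marks-!? q ⟨ trans ⟩
        cong just (cong₂ (λ s i → if s then (if i then peak else foot) else other) (sel-down q≺p sel-p) q∉P)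

    -- The selected pinnacles are the peaks and the selected non-pinnacles the feet: the neighbours
    -- of a selected pinnacle are lower, hence selected, and are not pinnacles themselves.
    pinnacles<non-pinnacles : ∀ p₀ → sel (w π p₀) ∧ inP (w π p₀) ≡ true →
      suc (countFin n (λ p → sel (w π p) ∧ inP (w π p))) ≤ countFin n (λ p → sel (w π p) ∧ not (inP (w π p)))
    pinnacles<non-pinnacles p₀ p₀-sel∈P = begin
      suc (countFin n (λ p → sel (w π p) ∧ inP (w π p)))
        ≡⟨ +-comm 1 _ ⟩
      countFin n (λ p → sel (w π p) ∧ inP (w π p)) + 1
        ≡⟨ cong₂ (λ c a → c + indicator a) (sym (#marks isPeak isPeak-mark)) (sym some-peak) ⟩
      count isPeak marks + indicator (any isPeak marks)
        ≤⟨ peaks<feet false marks flanked ⟩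
      count isFoot marks + 0
        ≡⟨ +-identityʳ _ ⟨ trans ⟩ #marks isFoot isFoot-mark ⟩
      countFin n (λ p → sel (w π p) ∧ not (inP (w π p))) ∎
      where
      open ≤-Reasoning
      #marks : ∀ (q : Mark → Bool) {f : El (suc t) n → Bool} → (∀ e → q (mark e) ≡ f e) →
               count q marks ≡ countFin n (f ∘ w π)
      #marks q q≗f = count-map q mark (L.tabulate (w π)) ⟨ trans ⟩ count-tabulate n (q ∘ mark) (w π) ⟨ trans ⟩
                     countFin-cong n (q≗f ∘ w π)
      some-peak : any isPeak marks ≡ true
      some-peak = any-peak marks (toℕ p₀)
        (marks-!? p₀ ⟨ trans ⟩ cong just (is-peak (sel (w π p₀)) (inP (w π p₀)) p₀-sel∈P))
        where
        is-peak : ∀ s i → s ∧ i ≡ true → (if s then (if i then peak else foot) else other) ≡ peak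
        is-peak true true _ = refl

  not-plain : ∀ y → not (isPlain (V.lookup statusVector y)) ≡ true → statusAt y ≢ plain
  not-plain y y-pin y-plain =
    case sym y-pin ⟨ trans ⟩ cong (not ∘ isPlain) (lookup∘tabulate statusAt y ⟨ trans ⟩ y-plain) of λ ()

  w-posOf-status : ∀ y → statusAt y ≢ plain → w π (posOf y) ≡ (colourOf (statusAt y) , y)
  w-posOf-status y ≢plain = w-posOf (statusAt-inP y ≢plain)

  #pinnacles : ℕ
  #pinnacles = countFin n (inP ∘ w π)

  #pinned : ℕ
  #pinned = #high statusVector + #low statusVector

  #pinned≤#pinnacles : #pinned ≤ #pinnacles
  #pinned≤#pinnacles = ≤-reflexive (#high+#low≡countFin statusVector) ⟨ ≤-trans ⟩
    countFin-injection n n _ _ posOf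
      (λ y y-pin → cong inP (w-posOf-status y (not-plain y y-pin)) ⟨ trans ⟩ statusAt-inP y (not-plain y y-pin))
      (λ y y′ y-pin y′-pin eq → cong proj₂ (sym (w-posOf-status y (not-plain y y-pin)) ⟨ trans ⟩ cong (w π) eq ⟨ trans ⟩
                                             w-posOf-status y′ (not-plain y′ y′-pin)))

  #pinned-bound : 1 ≤ n → suc (#pinned + #pinned) ≤ n
  #pinned-bound 1≤n with Fₚ.any? (λ p → inP (w π p) Bₚ.≟ true)
  ... | yes (p₀ , p₀∈P) =
    s≤s (+-mono-≤ #pinned≤#pinnacles #pinned≤#pinnacles) ⟨ ≤-trans ⟩
    ≤-reflexive (sym (+-suc #pinnacles #pinnacles)) ⟨ ≤-trans ⟩
    +-monoʳ-≤ #pinnacles (Selection.pinnacles<non-pinnacles (λ _ → true) (λ _ _ → refl) p₀ p₀∈P) ⟨ ≤-trans ⟩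
    ≤-reflexive (countFin-complement n (inP ∘ w π))
  ... | no none =
    subst (λ K → suc (K + K) ≤ n) (sym (n≤0⇒n≡0 (#pinned≤#pinnacles ⟨ ≤-trans ⟩ ≤-reflexive no-pinnacles))) 1≤n
    where
    no-pinnacles : #pinnacles ≡ 0
    no-pinnacles = countFin-none n λ p → ¬-not λ p∈P → none (p , p∈P)

  module LowPinnacle (x₀ : Fin n) (x₀-low : statusAt x₀ ≡ low) where

    low-inP : ∀ {y} → statusAt y ≡ low → inP (lowest , y) ≡ true
    low-inP {y} y-low = subst (λ s → inP (colourOf s , y) ≡ true) y-low
                              (statusAt-inP y λ y-plain → case sym y-low ⟨ trans ⟩ y-plain of λ ())

    -- The elements lying (weakly) below ξ^t(x₀).
    sel : El (suc t) n → Bool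
    sel (a , y) = does (a ≟ lowest) ∧ does (x₀ F.≤? y)

    sel-down : ∀ {e e′} → e′ ≺ e → sel e ≡ true → sel e′ ≡ true
    sel-down {a , y} e′≺e sel-e with ∧-true {does (a ≟ lowest)} sel-e
    ... | a≡lowest , x₀≤y with does-true (a ≟ lowest) a≡lowest | e′≺e
    ...   | refl | inj₁ lowest<a′        = ⊥-elim (¬lowest< _ lowest<a′)
    ...   | refl | inj₂ (refl , y<y′) =
      cong₂ _∧_ (dec-true (lowest {t} ≟ lowest) refl)
                (dec-true (x₀ F.≤? _) (≤-trans (does-true (x₀ F.≤? y) x₀≤y) (<⇒≤ y<y′)))

    open Selection sel sel-down

    p₀ : Fin n
    p₀ = posOf x₀

    p₀-sel∈P : sel (w π p₀) ∧ inP (w π p₀) ≡ true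
    p₀-sel∈P = cong (λ e → sel e ∧ inP e) (w-posOf (low-inP x₀-low)) ⟨ trans ⟩
      cong₂ _∧_ (cong₂ _∧_ (dec-true (lowest {t} ≟ lowest) refl) (dec-true (x₀ F.≤? x₀) ≤-refl)) (low-inP x₀-low)

    lows-above : countAbove isLow statusVector x₀ ≤
                 countFin n (λ p → (sel (w π p) ∧ inP (w π p)) ∧ not (does (p ≟ p₀)))
    lows-above = countFin-injection n n _ _ posOf maps-to
      (λ y y′ y-low y′-low eq →
        cong proj₂ (sym (w-posOf-low y-low) ⟨ trans ⟩ cong (w π) eq ⟨ trans ⟩ w-posOf-low y′-low))
      where
      low-above : ∀ {y} → does (x₀ F.<? y) ∧ isLow (V.lookup statusVector y) ≡ true → x₀ F.< y × statusAt y ≡ low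
      low-above {y} h with ∧-true {does (x₀ F.<? y)} h
      ... | x₀<y , y-low =
        does-true (x₀ F.<? y) x₀<y , isLow-true (cong isLow (sym (lookup∘tabulate statusAt y)) ⟨ trans ⟩ y-low)
        where
        isLow-true : ∀ {s : Status t} → isLow s ≡ true → s ≡ low
        isLow-true {low} _ = refl
      w-posOf-low : ∀ {y} → does (x₀ F.<? y) ∧ isLow (V.lookup statusVector y) ≡ true →
                    w π (posOf y) ≡ (lowest , y)
      w-posOf-low h = w-posOf (low-inP (proj₂ (low-above h)))
      maps-to : ∀ y → does (x₀ F.<? y) ∧ isLow (V.lookup statusVector y) ≡ true →
                (sel (w π (posOf y)) ∧ inP (w π (posOf y))) ∧ not (does (posOf y ≟ p₀)) ≡ true
      maps-to y h = cong₂ _∧_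
        (cong (λ e → sel e ∧ inP e) (w-posOf-low h) ⟨ trans ⟩
         cong₂ _∧_ (cong₂ _∧_ (dec-true (lowest {t} ≟ lowest) refl) (dec-true (x₀ F.≤? y) (<⇒≤ x₀<y)))
                   (low-inP (proj₂ (low-above h))))
        (cong not (dec-false (posOf y ≟ p₀) λ eq →
          Fₚ.<⇒≢ x₀<y (sym (cong proj₂ (sym (w-posOf-low h) ⟨ trans ⟩ cong (w π) eq ⟨ trans ⟩
                                         w-posOf (low-inP x₀-low))))))
        where
        x₀<y : x₀ F.< y
        x₀<y = proj₁ (low-above h)

    plains-above : countFin n (λ p → sel (w π p) ∧ not (inP (w π p))) ≤ countAbove isPlain statusVector x₀
    plains-above = countFin-injection n n _ _ (σ π) maps-to (λ _ _ _ _ → σ-inj π)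
      where
      maps-to : ∀ p → sel (w π p) ∧ not (inP (w π p)) ≡ true →
                does (x₀ F.<? σ π p) ∧ isPlain (V.lookup statusVector (σ π p)) ≡ true
      maps-to p h with ∧-true {sel (w π p)} h
      ... | sel-p , p∉P with ∧-true {does (colour π p ≟ lowest)} sel-p
      ...   | colour-lowest , x₀≤y =
        cong₂ _∧_ (dec-true (x₀ F.<? y) x₀<y) (cong isPlain (lookup∘tabulate statusAt y ⟨ trans ⟩ y-plain))
        where
        y = σ π p
        wp∉P : inP (w π p) ≡ false
        wp∉P = sym (Bₚ.not-involutive _) ⟨ trans ⟩ cong not p∉P
        w-p : w π p ≡ (lowest , y)
        w-p = cong (_, y) (does-true (colour π p ≟ lowest) colour-lowest)
        x₀<y : x₀ F.< y
        x₀<y = Fₚ.≤∧≢⇒< (does-true (x₀ F.≤? y) x₀≤y)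
                 λ { refl → case sym wp∉P ⟨ trans ⟩ cong inP w-p ⟨ trans ⟩ low-inP x₀-low of λ () }
        y-plain : statusAt y ≡ plain
        y-plain = statusAt-plain y λ a → ¬-not λ a∈P →
          case sym wp∉P ⟨ trans ⟩ cong inP (cong (w π) (sym (posOf-σ p)) ⟨ trans ⟩ w-posOf a∈P) ⟨ trans ⟩ a∈P of λ ()

    ballot : suc (suc (countAbove isLow statusVector x₀)) ≤ countAbove isPlain statusVector x₀
    ballot = s≤s (s≤s lows-above) ⟨ ≤-trans ⟩
             ≤-reflexive (cong suc (sym (countFin-remove n _ p₀ p₀-sel∈P))) ⟨ ≤-trans ⟩
             pinnacles<non-pinnacles p₀ p₀-sel∈P ⟨ ≤-trans ⟩
             plains-above

  admissible-statusVector : 1 ≤ n → admissibleᵇ statusVector ≡ true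
  admissible-statusVector 1≤n =
    cong₂ _∧_ (≤⇒≤ᵇ≡true (m+n≤o⇒m≤o (#high statusVector) K≤d))
              (cong₂ _∧_ (≤⇒≤ᵇ≡true (m+n≤o⇒m≤o∸n (#low statusVector) (subst (_≤ halfFloor n) #high+#low≡ K≤d))) ballot)
    where
    #high+#low≡ : #high statusVector + #low statusVector ≡ #low statusVector + #high statusVector
    #high+#low≡ = +-comm (#high statusVector) (#low statusVector)
    K≤d : #pinned ≤ halfFloor n
    K≤d = ≤-halfFloor _ (#pinned-bound 1≤n)
    ballot : ballotᵇ statusVector ≡ true
    ballot = ballotᵇ-intro statusVector λ x₀ x₀-low →
      LowPinnacle.ballot x₀ (sym (lookup∘tabulate statusAt x₀) ⟨ trans ⟩ x₀-low)

-- Arrangements with prescribed pinnacles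

module Arrangements {A : Set} (_⊏_ : A → A → Set)
                    (⊏-asym : ∀ {x y} → x ⊏ y → y ⊏ x → ⊥) (⊏-trans : ∀ {x y z} → x ⊏ y → y ⊏ z → x ⊏ z) where

  data Pinnacle : List A → A → Set where
    here  : ∀ {a e b xs} → a ⊏ e → b ⊏ e → Pinnacle (a ∷ e ∷ b ∷ xs) e
    there : ∀ {x xs e} → Pinnacle xs e → Pinnacle (x ∷ xs) e

  -- The shape of IsPinnacle, for an arbitrary arrangement f of length n.
  PinnacleAt : ∀ {n} → (Fin n → A) → A → Set
  PinnacleAt {n} f e = Σ (Fin n) λ h → Σ (Fin n) λ i → Σ (Fin n) λ j →
    (toℕ i ≡ suc (toℕ h)) × (toℕ j ≡ suc (toℕ i)) × (f i ≡ e) × (f j ⊏ f i) × (f h ⊏ f i)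

  PinnacleAt⇒Pinnacle : ∀ {n} (f : Fin n → A) {e} → PinnacleAt f e → Pinnacle (L.tabulate f) e
  PinnacleAt⇒Pinnacle f (F.zero , F.suc F.zero , F.suc (F.suc F.zero) , _ , _ , fi≡e , j<i , h<i) =
    subst (Pinnacle (L.tabulate f)) fi≡e (here h<i j<i)
  PinnacleAt⇒Pinnacle f (F.suc h , F.suc i , F.suc j , i≡h+1 , j≡i+1 , fi≡e , j<i , h<i) =
    there (PinnacleAt⇒Pinnacle (f ∘ F.suc) (h , i , j , suc-injective i≡h+1 , suc-injective j≡i+1 , fi≡e , j<i , h<i))
  PinnacleAt⇒Pinnacle f (F.zero , F.zero , _ , () , _)
  PinnacleAt⇒Pinnacle f (F.zero , F.suc (F.suc _) , _ , () , _)
  PinnacleAt⇒Pinnacle f (F.zero , F.suc F.zero , F.zero , _ , () , _)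
  PinnacleAt⇒Pinnacle f (F.zero , F.suc F.zero , F.suc F.zero , _ , () , _)
  PinnacleAt⇒Pinnacle f (F.zero , F.suc F.zero , F.suc (F.suc (F.suc _)) , _ , () , _)
  PinnacleAt⇒Pinnacle f (F.suc _ , F.zero , _ , () , _)
  PinnacleAt⇒Pinnacle f (F.suc _ , F.suc _ , F.zero , _ , () , _)

  Pinnacle⇒PinnacleAt : ∀ {n} (f : Fin n → A) {e} → Pinnacle (L.tabulate f) e → PinnacleAt f e
  Pinnacle⇒PinnacleAt {suc (suc (suc n))} f (here a<e b<e) =
    F.zero , F.suc F.zero , F.suc (F.suc F.zero) , refl , refl , refl , b<e , a<e
  Pinnacle⇒PinnacleAt {suc n} f (there p) with Pinnacle⇒PinnacleAt (f ∘ F.suc) p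
  ... | h , i , j , i≡h+1 , j≡i+1 , fi≡e , j<i , h<i =
    F.suc h , F.suc i , F.suc j , cong suc i≡h+1 , cong suc j≡i+1 , fi≡e , j<i , h<i

  Pinnacle-∷ : ∀ {x y zs e} → Pinnacle (x ∷ y ∷ zs) e → (x ⊏ y × e ≡ y) ⊎ Pinnacle (y ∷ zs) e
  Pinnacle-∷ (here x<e _) = inj₁ (x<e , refl)
  Pinnacle-∷ (there p)    = inj₂ p

  no-Pinnacle : ∀ {xs e} → Linked _⊏_ xs → ¬ Pinnacle xs e
  no-Pinnacle (_ ∷ e<b ∷ _) (here _ b<e) = ⊏-asym e<b b<e
  no-Pinnacle (_ ∷ linked)  (there p)    = no-Pinnacle linked p
  no-Pinnacle [-]           (there ())

  interleave  : List A → List A → List A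
  interleaveᵣ : List A → List A → List A
  interleave  []       qs = qs
  interleave  (a ∷ as) qs = a ∷ interleaveᵣ qs as
  interleaveᵣ []       as = as
  interleaveᵣ (q ∷ qs) as = q ∷ interleave as qs

  interleave-[] : ∀ as → interleave as [] ≡ as
  interleave-[] []       = refl
  interleave-[] (a ∷ as) = refl

  interleave-↭ : ∀ as qs → interleave as qs ↭ as ++ qs
  interleave-↭ []       qs       = ↭-refl
  interleave-↭ (a ∷ as) []       = ↭-reflexive (cong (a ∷_) (sym (Lₚ.++-identityʳ as)))
  interleave-↭ (a ∷ as) (q ∷ qs) = ↭-prep a (↭-prep q (interleave-↭ as qs) ⟨ ↭-trans ⟩ ↭-sym (↭ₚ.shift q as qs))

  Fits : List A → List A → Set
  Fits _             []       = ⊤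
  Fits (_ ∷ a′ ∷ as) (q ∷ qs) = a′ ⊏ q × Fits (a′ ∷ as) qs
  Fits _             (_ ∷ _)  = ⊥

  Pinnacle-interleave⇒∈ : ∀ {as qs e} → Linked _⊏_ as → Fits as qs → Pinnacle (interleave as qs) e → e ∈ qs
  Pinnacle-interleave⇒∈ {as} {[]} linked _ p =
    ⊥-elim (no-Pinnacle linked (subst (λ xs → Pinnacle xs _) (interleave-[] as) p))
  Pinnacle-interleave⇒∈ {a ∷ a′ ∷ as} {q ∷ qs} {e} (_ ∷ linked) (a′<q , fits) = peel
    where
    peel : Pinnacle (a ∷ q ∷ a′ ∷ interleaveᵣ qs as) e → e ∈ q ∷ qs
    peel (here _ _) = here refl
    peel (there p) with Pinnacle-∷ p
    ... | inj₁ (q<a′ , _) = ⊥-elim (⊏-asym a′<q q<a′)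
    ... | inj₂ p′         = there (Pinnacle-interleave⇒∈ linked fits p′)

  ∈⇒Pinnacle-interleave : ∀ {as qs e} → Linked _⊏_ as → Fits as qs → e ∈ qs → Pinnacle (interleave as qs) e
  ∈⇒Pinnacle-interleave {a ∷ a′ ∷ as} {q ∷ qs} (a<a′ ∷ _) (a′<q , _) (here refl) = here (⊏-trans a<a′ a′<q) a′<q
  ∈⇒Pinnacle-interleave {a ∷ a′ ∷ as} {q ∷ qs} (_ ∷ linked) (_ , fits) (there e∈qs) =
    there (there (∈⇒Pinnacle-interleave linked fits e∈qs))

  Fits-snocˡ : ∀ as qs {a} → Fits as qs → Fits (as L.∷ʳ a) qs
  Fits-snocˡ _             []       _          = tt
  Fits-snocˡ (_ ∷ a′ ∷ as) (q ∷ qs) (a′<q , fits) = a′<q , Fits-snocˡ (a′ ∷ as) qs fits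

  Fits-++ : ∀ as qs hs → Fits as qs → length qs + length hs < length as → All (λ h → All (_⊏ h) as) hs →
            Fits as (qs ++ hs)
  Fits-++ as                  []       []       _             _     _ = tt
  Fits-++ (a ∷ a′ ∷ as)       []       (h ∷ hs) _             (s≤s (s≤s long)) ((_ ∷ a′<h ∷ above) ∷ hs-above) =
    a′<h , Fits-++ (a′ ∷ as) [] hs tt (s≤s long) (All.map All.tail hs-above)
  Fits-++ (a ∷ a′ ∷ as)       (q ∷ qs) hs       (a′<q , fits) (s≤s long) hs-above =
    a′<q , Fits-++ (a′ ∷ as) qs hs fits long (All.map All.tail hs-above)
  Fits-++ (_ ∷ [])            []       (h ∷ hs) _             (s≤s ())     _
  Fits-++ []                  []       (h ∷ hs) _             ()           _

Linked-∷ʳ : ∀ {A : Set} {R : A → A → Set} {xs v} → Linked R xs → All (λ x → R x v) xs → Linked R (xs L.∷ʳ v)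
Linked-∷ʳ []           []                = [-]
Linked-∷ʳ [-]          (Rxv ∷ [])        = Rxv ∷ [-]
Linked-∷ʳ (Rxy ∷ linked) (_ ∷ below)     = Rxy ∷ Linked-∷ʳ linked below

∷ʳ-↭ : ∀ {A : Set} (xs ys zs : List A) v → xs ++ (ys L.∷ʳ v) ++ zs ↭ v ∷ xs ++ ys ++ zs
∷ʳ-↭ xs ys zs v =
  ↭-reflexive (cong (xs ++_) (Lₚ.++-assoc ys L.[ v ] zs)) ⟨ ↭-trans ⟩
  ↭ₚ.++⁺ˡ xs (↭ₚ.shift v ys zs) ⟨ ↭-trans ⟩ ↭ₚ.shift v xs (ys ++ zs)

Unique-tabulate⇒injective : ∀ {A : Set} {n} (h : Fin n → A) → Unique (L.tabulate h) → ∀ {i j} → h i ≡ h j → i ≡ j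
Unique-tabulate⇒injective h _              {F.zero}  {F.zero}  _  = refl
Unique-tabulate⇒injective h (h0∉ ∷ _)      {F.zero}  {F.suc j} eq = contradiction eq (Allₚ.tabulate⁻ h0∉ j)
Unique-tabulate⇒injective h (hi∉ ∷ _)      {F.suc i} {F.zero}  eq = contradiction (sym eq) (Allₚ.tabulate⁻ hi∉ i)
Unique-tabulate⇒injective h (_ ∷ unique)   {F.suc i} {F.suc j} eq =
  cong F.suc (Unique-tabulate⇒injective (h ∘ F.suc) unique eq)

-- The arrangement of an admissible status vector

open module ≺-Arrangements {t n : ℕ} = Arrangements (_≺_ {suc t} {n}) ≺-asym ≺-trans

module _ {t : ℕ} where

  shift : ∀ {n} → El (suc t) n → El (suc t) (suc n)
  shift (a , x) = a , F.suc x

  shift-≺ : ∀ {n} {e e′ : El (suc t) n} → e ≺ e′ → shift e ≺ shift e′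
  shift-≺ (inj₁ b<a)          = inj₁ b<a
  shift-≺ (inj₂ (refl , y<x)) = inj₂ (refl , s≤s y<x)

  -- The elements ξ^(colourOf s)(x + 1) for the values whose status s satisfies p, from the largest
  -- value down.
  withStatus : ∀ {n} → (Status t → Bool) → Vec (Status t) n → List (El (suc t) n)
  withStatus p []      = []
  withStatus p (s ∷ c) =
    if p s then map shift (withStatus p c) L.∷ʳ (colourOf s , F.zero) else map shift (withStatus p c)

  HasStatus : ∀ {n} → (Status t → Bool) → Vec (Status t) n → El (suc t) n → Set
  HasStatus p c (a , x) = a ≡ colourOf (V.lookup c x) × p (V.lookup c x) ≡ true

  withStatus-HasStatus : ∀ {n} p (c : Vec (Status t) n) → All (HasStatus p c) (withStatus p c)
  withStatus-HasStatus p []      = []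
  withStatus-HasStatus p (s ∷ c) with p s in ps
  ... | true  = Allₚ.++⁺ (Allₚ.map⁺ (withStatus-HasStatus p c)) ((refl , ps) ∷ [])
  ... | false = Allₚ.map⁺ (withStatus-HasStatus p c)

  length-withStatus : ∀ {n} p (c : Vec (Status t) n) → length (withStatus p c) ≡ countFin n (p ∘ V.lookup c)
  length-withStatus p []      = refl
  length-withStatus p (s ∷ c) with p s
  ... | true  = Lₚ.length-++ (map shift (withStatus p c)) ⟨ trans ⟩ +-comm _ 1 ⟨ trans ⟩
                cong suc (Lₚ.length-map shift (withStatus p c) ⟨ trans ⟩ length-withStatus p c)
  ... | false = Lₚ.length-map shift (withStatus p c) ⟨ trans ⟩ length-withStatus p c

  below-top : ∀ {n} {L : List (El (suc t) n)} →
    All (λ e → proj₁ e ≡ lowest) L → All (_≺ (lowest , F.zero)) (map shift L)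
  below-top = Allₚ.map⁺ ∘ All.map λ { {_ , _} refl → inj₂ (refl , z<s) }

  lowest-colours : ∀ {n} p (c : Vec (Status t) n) → (∀ s → p s ≡ true → colourOf s ≡ lowest) →
    All (λ e → proj₁ e ≡ lowest) (withStatus p c)
  lowest-colours p c p⇒lowest = All.map (λ { (a≡ , pa) → a≡ ⟨ trans ⟩ p⇒lowest _ pa }) (withStatus-HasStatus p c)

  withStatus-increasing : ∀ {n} p (c : Vec (Status t) n) →
    (∀ s → p s ≡ true → colourOf s ≡ lowest) → Linked _≺_ (withStatus p c)
  withStatus-increasing p []      _        = []
  withStatus-increasing p (s ∷ c) p⇒lowest with p s in ps
  ... | true  = Linked-∷ʳ (Linkedₚ.map⁺ (Linked.map shift-≺ (withStatus-increasing p c p⇒lowest)))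
                          (subst (λ a → All (_≺ (a , F.zero)) _) (sym (p⇒lowest s ps))
                                 (below-top (lowest-colours p c p⇒lowest)))
  ... | false = Linkedₚ.map⁺ (Linked.map shift-≺ (withStatus-increasing p c p⇒lowest))

  Fits-shift : ∀ {n} (as qs : List (El (suc t) n)) → Fits as qs → Fits (map shift as) (map shift qs)
  Fits-shift _             []       _             = tt
  Fits-shift (_ ∷ a′ ∷ as) (q ∷ qs) (a′≺q , fits) = shift-≺ a′≺q , Fits-shift (a′ ∷ as) qs fits

  isPlain⇒lowest : ∀ (s : Status t) → isPlain s ≡ true → colourOf s ≡ lowest
  isPlain⇒lowest plain _ = refl

  withStatus-fits : ∀ {n} (c : Vec (Status t) n) → ballotᵇ c ≡ true → Fits (withStatus isPlain c) (withStatus isLow c)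
  withStatus-fits []           _      = tt
  withStatus-fits (plain ∷ c)  ballot =
    Fits-snocˡ (map shift (withStatus isPlain c)) _ (Fits-shift _ _ (withStatus-fits c ballot))
  withStatus-fits (high _ ∷ c) ballot = Fits-shift _ _ (withStatus-fits c ballot)
  withStatus-fits (low ∷ c)    ballot with room , ballot′ ← ∧-true {suc (suc (#low c)) ≤ᵇ #plain c} ballot =
    Fits-++ (map shift Ps) (map shift Ls) L.[ lowest , F.zero ] (Fits-shift Ps Ls (withStatus-fits c ballot′)) long
            (below-top (lowest-colours isPlain c isPlain⇒lowest) ∷ [])
    where
    Ps = withStatus isPlain c
    Ls = withStatus isLow c
    long : length (map shift Ls) + 1 < length (map shift Ps)
    long = ≤-reflexive (cong suc (cong (_+ 1) (Lₚ.length-map shift Ls ⟨ trans ⟩ length-withStatus isLow c ⟨ trans ⟩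
                                              sym (#low≡countFin c))
                                 ⟨ trans ⟩ +-comm (#low c) 1)) ⟨ ≤-trans ⟩
           ≤ᵇ≡true⇒≤ room ⟨ ≤-trans ⟩
           ≤-reflexive (#plain≡countFin c ⟨ trans ⟩ sym (length-withStatus isPlain c) ⟨ trans ⟩
                        sym (Lₚ.length-map shift Ps))

  withStatus-↭ : ∀ {n} (c : Vec (Status t) n) →
    withStatus isPlain c ++ withStatus isLow c ++ withStatus isHigh c ↭ L.tabulate (λ x → colourOf (V.lookup c x) , x)
  withStatus-↭ []      = ↭-refl
  withStatus-↭ (s ∷ c) = move-head s ⟨ ↭-trans ⟩ ↭-prep (colourOf s , F.zero) tail-↭
    where
    Ps = map shift (withStatus isPlain c)
    Ls = map shift (withStatus isLow c)
    Hs = map shift (withStatus isHigh c)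
    move-head : ∀ s → withStatus isPlain (s ∷ c) ++ withStatus isLow (s ∷ c) ++ withStatus isHigh (s ∷ c)
                        ↭ (colourOf s , F.zero) ∷ Ps ++ Ls ++ Hs
    move-head plain    = ∷ʳ-↭ [] Ps (Ls ++ Hs) _
    move-head low      = ∷ʳ-↭ Ps Ls Hs _
    move-head (high k) =
      ↭-reflexive (sym (Lₚ.++-assoc Ps Ls _) ⟨ trans ⟩ cong ((Ps ++ Ls) ++_) (sym (Lₚ.++-identityʳ _))) ⟨ ↭-trans ⟩
      ∷ʳ-↭ (Ps ++ Ls) Hs [] _ ⟨ ↭-trans ⟩
      ↭-reflexive (cong (_ ∷_) (Lₚ.++-assoc Ps Ls (Hs ++ []) ⟨ trans ⟩
                                cong (λ hs → Ps ++ Ls ++ hs) (Lₚ.++-identityʳ Hs)))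
    tail-↭ : Ps ++ Ls ++ Hs ↭ L.tabulate (λ x → colourOf (V.lookup c x) , F.suc x)
    tail-↭ = ↭-reflexive (sym (Lₚ.map-++ shift (withStatus isPlain c) _ ⟨ trans ⟩
                               cong (Ps ++_) (Lₚ.map-++ shift (withStatus isLow c) _))) ⟨ ↭-trans ⟩
             ↭ₚ.map⁺ shift (withStatus-↭ c) ⟨ ↭-trans ⟩ ↭-reflexive (Lₚ.map-tabulate _ shift)

isPlain-true : ∀ {t} {s : Status t} → isPlain s ≡ true → s ≡ plain
isPlain-true {s = plain} _ = refl

isIn-true : ∀ {t} {a : Fin (suc t)} s → isIn a s ≡ true → a ≡ colourOf s × s ≢ plain
isIn-true {a = a} low      h = does-true (a ≟ lowest) h , λ ()
isIn-true {a = a} (high k) h = does-true (a ≟ inject₁ k) h , λ ()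

fromList : ∀ {A : Set} {n} (xs : List A) → length xs ≡ n → Σ (Fin n → A) λ f → L.tabulate f ≡ xs
fromList xs refl = L.lookup xs , Lₚ.tabulate-lookup xs

module ArrangementOfStatus {t n : ℕ} (c : Vec (Status t) n) (c-admissible : admissibleᵇ c ≡ true) (1≤n : 1 ≤ n) where

  plains lows highs : List (El (suc t) n)
  plains = withStatus isPlain c
  lows   = withStatus isLow c
  highs  = withStatus isHigh c

  arrangement : List (El (suc t) n)
  arrangement = interleave plains (lows ++ highs)

  arrangement-↭ : arrangement ↭ L.tabulate (λ x → colourOf (V.lookup c x) , x)
  arrangement-↭ = interleave-↭ plains (lows ++ highs) ⟨ ↭-trans ⟩ withStatus-↭ c

  fits : Fits plains (lows ++ highs)
  fits with #high≤d , rest ← ∧-true {#high c ≤ᵇ halfFloor n} c-admissible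
       with #low≤d-#high , ballot ← ∧-true {#low c ≤ᵇ halfFloor n ∸ #high c} rest =
    Fits-++ plains lows highs (withStatus-fits c ballot) long
      (All.map (λ { {_ , x} (a≡ , high-x) → All.map (λ { {_ , y} (b≡ , plain-y) → above x y a≡ high-x b≡ plain-y })
                                                     (withStatus-HasStatus isPlain c) })
               (withStatus-HasStatus isHigh c))
    where
    d = halfFloor n
    K = #high c + #low c
    K≤d : K ≤ d
    K≤d = +-monoʳ-≤ (#high c) (≤ᵇ≡true⇒≤ {#low c} {d ∸ #high c} #low≤d-#high) ⟨ ≤-trans ⟩
          ≤-reflexive (m+[n∸m]≡n (≤ᵇ≡true⇒≤ {#high c} {d} #high≤d))
    K<#plain : #low c + #high c < #plain c
    K<#plain = +-cancelʳ-≤ K _ _ (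
      ≤-reflexive (cong (λ k → suc (k + K)) (+-comm (#low c) (#high c))) ⟨ ≤-trans ⟩
      s≤s (+-mono-≤ K≤d K≤d) ⟨ ≤-trans ⟩ halfFloor-double n 1≤n ⟨ ≤-trans ⟩ ≤-reflexive (sym (#plain+#high+#low c)))
    length-withStatus′ : ∀ p {k} → k ≡ countFin n (p ∘ V.lookup c) → length (withStatus p c) ≡ k
    length-withStatus′ p k≡ = length-withStatus p c ⟨ trans ⟩ sym k≡
    long : length lows + length highs < length plains
    long = subst₂ _<_ (sym (cong₂ _+_ (length-withStatus′ isLow (#low≡countFin c))
                                      (length-withStatus′ isHigh (#high≡countFin c))))
                      (sym (length-withStatus′ isPlain (#plain≡countFin c))) K<#plain
    above : ∀ x y {a b} → a ≡ colourOf (V.lookup c x) → isHigh (V.lookup c x) ≡ true →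
            b ≡ colourOf (V.lookup c y) → isPlain (V.lookup c y) ≡ true → (b , y) ≺ (a , x)
    above x y a≡ high-x b≡ plain-y with V.lookup c x | V.lookup c y
    above x y refl _ refl _ | high k | plain = lowest≺high k y x

  length-arrangement : length arrangement ≡ n
  length-arrangement = ↭ₚ.↭-length arrangement-↭ ⟨ trans ⟩ Lₚ.length-tabulate _

  arrangementAt : Fin n → El (suc t) n
  arrangementAt = proj₁ (fromList arrangement length-arrangement)

  tabulate-arrangementAt : L.tabulate arrangementAt ≡ arrangement
  tabulate-arrangementAt = proj₂ (fromList arrangement length-arrangement)

  values-unique : Unique (L.tabulate (proj₂ ∘ arrangementAt))
  values-unique = ↭ₛₚ.Unique-resp-↭ (≡-setoid (Fin n)) (↭⇒↭ₛ values-↭) (Uniqueₚ.allFin⁺ n)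
    where
    values-↭ : L.allFin n ↭ L.tabulate (proj₂ ∘ arrangementAt)
    values-↭ = ↭-reflexive (sym (Lₚ.map-tabulate (λ x → colourOf (V.lookup c x) , x) proj₂)) ⟨ ↭-trans ⟩
               ↭ₚ.map⁺ proj₂ (↭-sym arrangement-↭) ⟨ ↭-trans ⟩
               ↭-reflexive (cong (map proj₂) (sym tabulate-arrangementAt) ⟨ trans ⟩ Lₚ.map-tabulate arrangementAt proj₂)

  π : ColPerm (suc t) n
  π = record
    { colour = proj₁ ∘ arrangementAt
    ; σ      = proj₂ ∘ arrangementAt
    ; σ-inj  = Unique-tabulate⇒injective (proj₂ ∘ arrangementAt) values-unique
    }

  HasStatus⇒isIn : ∀ p {a x} → (∀ {s} → p s ≡ true → s ≢ plain) → HasStatus p c (a , x) → isIn a (V.lookup c x) ≡ true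
  HasStatus⇒isIn p {x = x} p⇒pinned (a≡ , ps) =
    subst (λ b → isIn b (V.lookup c x) ≡ true) (sym a≡) (isIn-colourOf _ (p⇒pinned ps))

  pinned⇒isIn : ∀ {a x} → (a , x) ∈ lows ++ highs → isIn a (V.lookup c x) ≡ true
  pinned⇒isIn a,x∈ with ∈-++⁻ lows a,x∈
  ... | inj₁ ∈lows  = HasStatus⇒isIn isLow  (λ { {low} _ () })    (All.lookup (withStatus-HasStatus isLow c) ∈lows)
  ... | inj₂ ∈highs = HasStatus⇒isIn isHigh (λ { {high _} _ () }) (All.lookup (withStatus-HasStatus isHigh c) ∈highs)

  isIn⇒pinned : ∀ {a x} → isIn a (V.lookup c x) ≡ true → (a , x) ∈ lows ++ highs
  isIn⇒pinned {a} {x} in-set with a≡ , not-plain ← isIn-true (V.lookup c x) in-set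
                              with ∈-++⁻ plains (↭ₚ.∈-resp-↭ (↭-sym (withStatus-↭ c))
                                                   (subst (λ b → (b , x) ∈ _) (sym a≡) (∈-tabulate⁺ x)))
  ... | inj₁ ∈plains = ⊥-elim (not-plain (isPlain-true (proj₂ (All.lookup (withStatus-HasStatus isPlain c) ∈plains))))
  ... | inj₂ ∈pinned = ∈pinned

  isPinSet : IsPinSet π (encode c)
  isPinSet (a , x) = mk⇔
    (λ a,x∈P → Pinnacle⇒PinnacleAt arrangementAt (subst (λ xs → Pinnacle xs (a , x)) (sym tabulate-arrangementAt)
                 (∈⇒Pinnacle-interleave increasing fits (isIn⇒pinned (sym (lookup-encode c a x) ⟨ trans ⟩ a,x∈P)))))
    (λ pinnacle → lookup-encode c a x ⟨ trans ⟩ pinned⇒isIn (Pinnacle-interleave⇒∈ increasing fits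
                 (subst (λ xs → Pinnacle xs (a , x)) tabulate-arrangementAt
                        (PinnacleAt⇒Pinnacle arrangementAt pinnacle))))
    where
    increasing : Linked _≺_ plains
    increasing = withStatus-increasing isPlain c isPlain⇒lowest

-- The admissible pinnacle sets

admissibleSets : ∀ t n → List (SubsetI (suc t) n)
admissibleSets t n = map encode (filterᵇ admissibleᵇ (allStatusVectors t n))

admissibleSets-unique : ∀ t n → Unique (admissibleSets t n)
admissibleSets-unique t n =
  Uniqueₚ.map⁺ encode-injective (Uniqueₚ.filter⁺ (T? ∘ admissibleᵇ) (allStatusVectors-unique t n))

∈-admissibleSets : ∀ t n → 1 ≤ n → ∀ P → P ∈ admissibleSets t n ⇔ Admissible (suc t) n P
∈-admissibleSets t n 1≤n P = mk⇔ to from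
  where
  to : P ∈ admissibleSets t n → Admissible (suc t) n P
  to P∈ with c , c∈ , refl ← ∈-map⁻ encode P∈
        with _ , c-admissible ← ∈-filter⁻ (T? ∘ admissibleᵇ) {xs = allStatusVectors t n} c∈ =
    ArrangementOfStatus.π c adm 1≤n , ArrangementOfStatus.isPinSet c adm 1≤n
    where
    adm : admissibleᵇ c ≡ true
    adm = Equivalence.to T-≡ c-admissible
  from : Admissible (suc t) n P → P ∈ admissibleSets t n
  from (π , P-pin) = subst (_∈ admissibleSets t n) encode-statusVector
    (∈-map⁺ encode (∈-filter⁺ (T? ∘ admissibleᵇ) (∈-allStatusVectors statusVector)
                                                  (Equivalence.from T-≡ (admissible-statusVector 1≤n))))
    where open StatusOfPinnacleSet π P P-pin

length-admissibleSets : ∀ t n → 1 ≤ n → length (admissibleSets t n) ≡ closedForm t n (halfFloor n)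
length-admissibleSets t n 1≤n =
  Lₚ.length-map encode (filterᵇ admissibleᵇ (allStatusVectors t n)) ⟨ trans ⟩
  length-filterᵇ admissibleᵇ (allStatusVectors t n) ⟨ trans ⟩ count-admissible t n 1≤n

mainTheorem5 : (m n : ℕ) → 2 ≤ n → 1 ≤ m →
    Σ ℕ λ N → NumAPS m n N × (ℤ.+ N ≡ formulaℤ m n) × (N ≡ formulaℕ m n)
mainTheorem5 (suc t) n 2≤n _ =
  closedForm t n d ,
  (admissibleSets t n , admissibleSets-unique t n , ∈-admissibleSets t n 1≤n , length-admissibleSets t n 1≤n) ,
  closedForm≡signedForm t n d d≤n ,
  sym (formulaℕ≡closedForm t n)
  where
  d = halfFloor n
  1≤n : 1 ≤ n
  1≤n = ≤-trans (n≤1+n 1) 2≤n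
  d≤n : d ≤ n
  d≤n = m≤m+n d d ⟨ ≤-trans ⟩ n≤1+n (d + d) ⟨ ≤-trans ⟩ halfFloor-double n 1≤n
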